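{- There exists a constant $c>0$ such that the following holds for every $n$. For every integer $m\ge3$, there is a symmetric $e^{ -cn/m^2}$-biased distribution $D$ on $\{0,1\}^n$ such that for every string $z\in\{0,1\}^n$ of Hamming weight at most $\lfloor m/2\rfloor-1$, there exists a symmetric function $f\colon\{0,1\}^n\to\{0,1\}$ such that $f(D\oplus z)=0$ with probability $1$ and $\Pr[f(U)=1]\ge 1/m-e^{ -cn/m^2}$, where $U$ is uniform on $\{0,1\}^n$.
   Context: A distribution $D$ on $\{0,1\}^n$ is $\varepsilon$-biased if $|\mathbb{E}[(-1)^{\sum_{i\in S}D_i}]|\le\varepsilon$ for every nonempty $S\subseteq[n]$. Distributions and functions are symmetric if invariant under permutations of coordinates. $\oplus$ is bitwise xor. -}

module Defs where

open import Data.Bool using (Bool; true; false; _xor_; _∧_; if_then_else_)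
open import Data.Nat as ℕ using (ℕ; zero; suc)
open import Data.Fin using (Fin)
open import Data.Vec using (Vec; []; _∷_; tabulate; lookup; zipWith; foldr; map; count)
open import Data.List as List using (List; []; _∷_; _++_)
open import Data.Integer using (+_)
open import Data.Rational using (ℚ; 0ℚ; 1ℚ; _+_; _*_; _-_; -_; _≤_; _<_; ∣_∣; _/_)
open import Data.Product using (∃; _×_; Σ)
open import Data.Sum using (_⊎_)
open import Data.Fin.Permutation using (Permutation′; _⟨$⟩ʳ_)
open import Relation.Binary.PropositionalEquality using (_≡_)
open import Relation.Nullary using (¬_)
open import Relation.Nullary.Decidable using (does)
open import Data.Bool.Properties using () renaming (_≟_ to _≟ᵇ_)

-- Bit strings in {0,1}^n, with true = 1.
Bits : ℕ → Set
Bits n = Vec Bool n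

allBits : (n : ℕ) → List (Bits n)
allBits zero    = [] ∷ []
allBits (suc n) = List.map (false ∷_) (allBits n) ++ List.map (true ∷_) (allBits n)

sumℚ : ∀ {n} → (Bits n → ℚ) → ℚ
sumℚ {n} g = List.foldr (λ x acc → g x + acc) 0ℚ (allBits n)

_^ℚ_ : ℚ → ℕ → ℚ
q ^ℚ zero  = 1ℚ
q ^ℚ suc k = q * (q ^ℚ k)

_⊕_ : ∀ {n} → Bits n → Bits n → Bits n
x ⊕ y = zipWith _xor_ x y

weight : ∀ {n} → Bits n → ℕ
weight x = count (λ b → b ≟ᵇ true) x

permute : ∀ {n} → Permutation′ n → Bits n → Bits n
permute π x = tabulate (λ i → lookup x (π ⟨$⟩ʳ i))

IsDistribution : ∀ {n} → (Bits n → ℚ) → Set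
IsDistribution D = (∀ x → 0ℚ ≤ D x) × sumℚ D ≡ 1ℚ

SymmetricDist : ∀ {n} → (Bits n → ℚ) → Set
SymmetricDist {n} D = ∀ (π : Permutation′ n) x → D (permute π x) ≡ D x

SymmetricFun : ∀ {n} → (Bits n → Bool) → Set
SymmetricFun {n} f = ∀ (π : Permutation′ n) x → f (permute π x) ≡ f x

-- Subsets S ⊆ [n] as indicator vectors; nonempty = some entry true.
Nonempty : ∀ {n} → Vec Bool n → Set
Nonempty S = ∃ λ i → lookup S i ≡ true

parity : ∀ {n} → Vec Bool n → Bits n → Bool
parity S x = foldr _ _xor_ false (zipWith _∧_ S x)

sign : Bool → ℚ
sign false = 1ℚ
sign true  = - 1ℚ

bias : ∀ {n} → (Bits n → ℚ) → Vec Bool n → ℚ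
bias D S = sumℚ (λ x → D x * sign (parity S x))

-- x ≤ 2^(-a/b)  (for b > 0), expressed without reals:
-- either x ≤ 0, or x^b · 2^a ≤ 1.
LeTwoPow : ℚ → (a b : ℕ) → Set
LeTwoPow x a b = (x ≤ 0ℚ) ⊎ ((x ^ℚ b) * ((+ 2 / 1) ^ℚ a) ≤ 1ℚ)

Biased : ∀ {n} → (Bits n → ℚ) → (a b : ℕ) → Set
Biased {n} D a b = ∀ (S : Vec Bool n) → Nonempty S → LeTwoPow ∣ bias D S ∣ a b

probUniform : ∀ {n} → (Bits n → Bool) → ℚ
probUniform {n} f = sumℚ (λ x → if f x then ((+ 1 / 2) ^ℚ n) else 0ℚ)

-- The constant e^{-cn/m^2} is written as 2^{-(p/r)·n/m^2} with p, r ≥ 1; a = p·n, b = r·m^2.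

-- 1/m (m ≥ 1 in all uses; value at 0 irrelevant).
oneOver : ℕ → ℚ
oneOver zero    = 0ℚ
oneOver (suc k) = + 1 / suc k

-- Let h = ⌊m/2⌋ and M = 2h + 1. D is uniform on the strings whose weight is
-- divisible by M, and f accepts the weights congruent to h or h + 1 modulo M:
-- flipping fewer than h bits cannot move a multiple of M into these two
-- classes, which together have density about 2/M ≥ 1/m.
--
-- For S ⊆ [n] the M-periodic sequence v_S(r) = Σₓ [M ∣ |x| + r] (−1)^(Σ_{i∈S} xᵢ)
-- satisfies v_{b∷S} = v_S ± (v_S shifted by one). Both operations multiply the
-- dispersion M Σ v² − (Σ v)² by at most 4 − 1/M²: for the sum this is a
-- discrete Poincaré inequality, for the difference it amounts to inverting
-- v ↦ v + (v shifted by one), which is possible because M is odd. As Σᵣ v_S(r)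
-- is 0 for S ≠ ∅ and 2ⁿ for S = ∅, after n steps the bias of D and the
-- deviation of each of the two classes from density 1/M are at most
-- 2M(1 − 1/4M²)^(n/2), which is below 2^(−n/128m²) (so c = (ln 2)/128) as soon
-- as 2^(−n/128m²) < 1/m. Otherwise the uniform D and f = 0 already work.

{-# OPTIONS --safe #-}
module Submission where

open import Defs

open import Algebra.Bundles using (CommutativeRing)
open import Data.Bool using (Bool; true; false; not; _∨_; _xor_; if_then_else_)
open import Data.Bool.Properties using (xor-assoc; xor-same; xor-identityʳ)
open import Data.Empty using (⊥; ⊥-elim)
open import Data.Fin as Fin using (toℕ)
open import Data.Fin.Permutation using (Permutation′; _⟨$⟩ʳ_)
import Data.Integer as ℤ
import Data.Integer.Properties as ℤ
open import Data.List as List using (List; []; _∷_)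
open import Data.Nat as ℕ using (ℕ; zero; suc; s≤s; z≤n)
open import Data.Nat.DivMod using (_/_; m/n*n≤m; m≥n⇒m/n>0)
open import Data.Nat.Divisibility using (_∣_; _∣?_; ∣m+n∣m⇒∣n; ∣m∣n⇒∣m+n; ∣-refl; _∣0; >⇒∤; ∣⇒≤; ∣1⇒≡1)
import Data.Nat.Properties as ℕ
open import Data.Nat.Tactic.RingSolver using () renaming (solve-∀ to ℕ-solve-∀)
open import Data.Product using (Σ; _×_; _,_)
import Data.Rational as ℚ
open import Data.Rational using (ℚ; 0ℚ; 1ℚ; _+_; _*_; _-_; -_; _≤_; _<_; 1/_; *≤*; *<*; toℚᵘ; nonNegative; nonPositive; positive)
open import Data.Rational.Properties
import Data.Rational.Unnormalised as ℚᵘ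
open import Data.Rational.Unnormalised using (mkℚᵘ; *≡*) renaming (_≃_ to _≃ᵘ_)
import Data.Rational.Unnormalised.Properties as ℚᵘ
open import Data.Sum using (inj₁; inj₂)
open import Data.Vec as Vec using (Vec; []; _∷_)
import Data.Vec.Properties as Vec
open import Function using (_∘_)
open import Function.Bundles using (_⇔_; mk⇔)
open import Level using (0ℓ)
open import Relation.Binary.PropositionalEquality using (_≡_; refl; sym; trans; cong; cong₂; subst; subst₂; module ≡-Reasoning)
open import Relation.Nullary using (¬_; Dec; yes; no)
open import Relation.Nullary.Decidable using (dec⇒maybe; does; does-⇔; dec-true; dec-false)
open import Tactic.RingSolver using (solve-∀)
open import Tactic.RingSolver.Core.AlmostCommutativeRing using (AlmostCommutativeRing; fromCommutativeRing)

open CommutativeRing +-*-commutativeRing using (commutativeSemiring; semiring)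
open import Algebra.Properties.CommutativeSemiring.Exp commutativeSemiring using (_^_; ^-homo-*; ^-assocʳ; ^-distrib-*)
open import Algebra.Properties.CommutativeMonoid.Sum +-0-commutativeMonoid using (sum; ∑-distrib-+; sum-cong-≗; sum-replicate)
open import Algebra.Properties.CommutativeMonoid.Sum ℕ.+-0-commutativeMonoid
  using () renaming (sum to ℕ-sum; sum-cong-≗ to ℕ-sum-cong-≗; sum-permute to ℕ-sum-permute)
open import Algebra.Properties.Group +-0-group using () renaming (∙-cancelˡ to +-cancelˡ)
open import Algebra.Properties.Semiring.Mult semiring using (×-homo-+; ×1-homo-*; ×-assoc-*) renaming (_×_ to _×ℚ_)
open import Algebra.Properties.Semiring.Sum semiring using (*-distribˡ-sum)

ℚ-ring : AlmostCommutativeRing 0ℓ 0ℓ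
ℚ-ring = fromCommutativeRing +-*-commutativeRing (λ x → dec⇒maybe (0ℚ ≟ x))

infixl 10 _²
_² : ℚ → ℚ
x ² = x * x

two four : ℚ
two = 1ℚ + 1ℚ
four = two + two

0≤1 : 0ℚ ≤ 1ℚ
0≤1 = *≤* (ℤ.+≤+ z≤n)

0<1 : 0ℚ < 1ℚ
0<1 = *<* (ℤ.+<+ (s≤s z≤n))

0≤p+q : ∀ {p q} → 0ℚ ≤ p → 0ℚ ≤ q → 0ℚ ≤ p + q
0≤p+q 0≤p 0≤q = +-mono-≤ 0≤p 0≤q

0≤two : 0ℚ ≤ two
0≤two = 0≤p+q 0≤1 0≤1

0≤four : 0ℚ ≤ four
0≤four = 0≤p+q 0≤two 0≤two

0≤p*q : ∀ {p q} → 0ℚ ≤ p → 0ℚ ≤ q → 0ℚ ≤ p * q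
0≤p*q {p} {q} 0≤p 0≤q = nonNegative⁻¹ (p * q) {{nonNeg*nonNeg⇒nonNeg p {{nonNegative 0≤p}} q {{nonNegative 0≤q}}}}

0<p*q : ∀ {p q} → 0ℚ < p → 0ℚ < q → 0ℚ < p * q
0<p*q {p} {q} 0<p 0<q = positive⁻¹ (p * q) {{pos*pos⇒pos p {{positive 0<p}} q {{positive 0<q}}}}

0≤p² : ∀ p → 0ℚ ≤ p ²
0≤p² p with ≤-total 0ℚ p
... | inj₁ 0≤p = 0≤p*q 0≤p 0≤p
... | inj₂ p≤0 = nonNegative⁻¹ (p * p) {{nonPos*nonPos⇒nonPos p {{nonPositive p≤0}} p {{nonPositive p≤0}}}}

p≤q⇒0≤q-p : ∀ {p q} → p ≤ q → 0ℚ ≤ q - p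
p≤q⇒0≤q-p {p} {q} p≤q = subst (_≤ q - p) (+-inverseʳ p) (+-monoˡ-≤ (- p) p≤q)

q-p+p≡q : ∀ p q → q - p + p ≡ q
q-p+p≡q = solve-∀ ℚ-ring

0≤q-p⇒p≤q : ∀ {p q} → 0ℚ ≤ q - p → p ≤ q
0≤q-p⇒p≤q {p} {q} 0≤q-p = subst₂ _≤_ (+-identityˡ p) (q-p+p≡q p q) (+-monoˡ-≤ p 0≤q-p)

0<q-p⇒p<q : ∀ {p q} → 0ℚ < q - p → p < q
0<q-p⇒p<q {p} {q} 0<q-p = subst₂ _<_ (+-identityˡ p) (q-p+p≡q p q) (+-monoˡ-< p 0<q-p)

≤-byDifference : ∀ {p q} d → 0ℚ ≤ d → q - p ≡ d → p ≤ q
≤-byDifference d 0≤d q-p≡d = 0≤q-p⇒p≤q (subst (0ℚ ≤_) (sym q-p≡d) 0≤d)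

p≤p+q : ∀ {p q} → 0ℚ ≤ q → p ≤ p + q
p≤p+q {p} {q} 0≤q = subst (_≤ p + q) (+-identityʳ p) (+-monoʳ-≤ p 0≤q)

*-mono-≤-nonNeg : ∀ {p q r s} → 0ℚ ≤ p → 0ℚ ≤ r → p ≤ q → r ≤ s → p * r ≤ q * s
*-mono-≤-nonNeg {p} {q} {r} {s} 0≤p 0≤r p≤q r≤s = ≤-trans
  (*-monoʳ-≤-nonNeg r {{nonNegative 0≤r}} p≤q)
  (*-monoˡ-≤-nonNeg q {{nonNegative (≤-trans 0≤p p≤q)}} r≤s)

*-monoˡ-≤-0≤ : ∀ {p q} r → 0ℚ ≤ r → p ≤ q → r * p ≤ r * q
*-monoˡ-≤-0≤ r 0≤r = *-monoˡ-≤-nonNeg r {{nonNegative 0≤r}}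

*-monoʳ-≤-0≤ : ∀ {p q} r → 0ℚ ≤ r → p ≤ q → p * r ≤ q * r
*-monoʳ-≤-0≤ r 0≤r = *-monoʳ-≤-nonNeg r {{nonNegative 0≤r}}

p*q≤1 : ∀ {p q} → 0ℚ ≤ p → p ≤ 1ℚ → 0ℚ ≤ q → q ≤ 1ℚ → p * q ≤ 1ℚ
p*q≤1 {p} {q} 0≤p p≤1 0≤q q≤1 = subst (p * q ≤_) (*-identityˡ 1ℚ) (*-mono-≤-nonNeg 0≤p 0≤q p≤1 q≤1)

p²≤b²⇒-b≤p : ∀ {p b} → 0ℚ ≤ b → p ² ≤ b ² → - b ≤ p
p²≤b²⇒-b≤p {p} {b} 0≤b p²≤b² with - b ≤? p
... | yes -b≤p = -b≤p
... | no  -b≰p = ⊥-elim (<-irrefl refl (<-≤-trans b²<p² p²≤b²))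
  where
  0<-b-p : 0ℚ < - b - p
  0<-b-p = subst (_< - b - p) (+-inverseʳ p) (+-monoˡ-< (- p) (≰⇒> -b≰p))
  0<-b-p+2b : 0ℚ < - b - p + (b + b)
  0<-b-p+2b = subst (_< - b - p + (b + b)) (+-identityʳ 0ℚ) (+-mono-<-≤ 0<-b-p (0≤p+q 0≤b 0≤b))
  factor : ∀ p b → (- b - p) * (- b - p + (b + b)) ≡ p * p - b * b
  factor = solve-∀ ℚ-ring
  b²<p² : b ² < p ²
  b²<p² = 0<q-p⇒p<q (subst (0ℚ <_) (factor p b) (0<p*q 0<-b-p 0<-b-p+2b))

1≤p*q⇒0<q : ∀ {p q} → 0ℚ ≤ p → 1ℚ ≤ p * q → 0ℚ < q
1≤p*q⇒0<q {p} {q} 0≤p 1≤pq with 0ℚ <? q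
... | yes 0<q = 0<q
... | no  0≮q = ⊥-elim (<-irrefl refl (<-≤-trans 0<1 (≤-trans 1≤pq pq≤0)))
  where
  pq≤0 : p * q ≤ 0ℚ
  pq≤0 = nonPositive⁻¹ (p * q) {{nonNeg*nonPos⇒nonPos p {{nonNegative 0≤p}} q {{nonPositive (≮⇒≥ 0≮q)}}}}

∣p∣²≡p² : ∀ p → ℚ.∣ p ∣ ² ≡ p ²
∣p∣²≡p² p = trans (sym (∣p*q∣≡∣p∣*∣q∣ p p)) (0≤p⇒∣p∣≡p (0≤p² p))

^ℚ≗^ : ∀ p k → p ^ℚ k ≡ p ^ k
^ℚ≗^ p zero    = refl
^ℚ≗^ p (suc k) = cong (p *_) (^ℚ≗^ p k)

0≤p^k : ∀ {p} k → 0ℚ ≤ p → 0ℚ ≤ p ^ k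
0≤p^k zero    0≤p = 0≤1
0≤p^k (suc k) 0≤p = 0≤p*q 0≤p (0≤p^k k 0≤p)

^-monoˡ-≤ : ∀ {p q} k → 0ℚ ≤ p → p ≤ q → p ^ k ≤ q ^ k
^-monoˡ-≤ zero    0≤p p≤q = ≤-refl
^-monoˡ-≤ (suc k) 0≤p p≤q = *-mono-≤-nonNeg 0≤p (0≤p^k k 0≤p) p≤q (^-monoˡ-≤ k 0≤p p≤q)

p^k≤1 : ∀ {p} k → 0ℚ ≤ p → p ≤ 1ℚ → p ^ k ≤ 1ℚ
p^k≤1 zero    0≤p p≤1 = ≤-refl
p^k≤1 {p} (suc k) 0≤p p≤1 = subst (p * p ^ k ≤_) (*-identityˡ 1ℚ)
  (*-mono-≤-nonNeg 0≤p (0≤p^k k 0≤p) p≤1 (p^k≤1 k 0≤p p≤1))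

^-antimonoʳ-≤ : ∀ {p j k} → 0ℚ ≤ p → p ≤ 1ℚ → j ℕ.≤ k → p ^ k ≤ p ^ j
^-antimonoʳ-≤ {p} {j} {k} 0≤p p≤1 j≤k = begin
  p ^ k                 ≡⟨ cong (p ^_) (sym (ℕ.m+[n∸m]≡n j≤k)) ⟩
  p ^ (j ℕ.+ (k ℕ.∸ j)) ≡⟨ ^-homo-* p j (k ℕ.∸ j) ⟩
  p ^ j * p ^ (k ℕ.∸ j) ≤⟨ *-monoˡ-≤-0≤ (p ^ j) (0≤p^k j 0≤p) (p^k≤1 (k ℕ.∸ j) 0≤p p≤1) ⟩
  p ^ j * 1ℚ            ≡⟨ *-identityʳ (p ^ j) ⟩
  p ^ j                 ∎
  where open ≤-Reasoning

1^n : ∀ n → 1ℚ ^ n ≡ 1ℚ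
1^n zero    = refl
1^n (suc n) = trans (*-identityˡ (1ℚ ^ n)) (1^n n)

p^k*r≤1<q^k*r⇒p≤q : ∀ {p q r} k → 0ℚ ≤ q → 0ℚ ≤ r → p ^ k * r ≤ 1ℚ → 1ℚ < q ^ k * r → p ≤ q
p^k*r≤1<q^k*r⇒p≤q {p} {q} {r} k 0≤q 0≤r p^kr≤1 1<q^kr with ≤-total p q
... | inj₁ p≤q = p≤q
... | inj₂ q≤p = ⊥-elim (<-irrefl refl (<-≤-trans 1<q^kr
      (≤-trans (*-monoʳ-≤-0≤ r 0≤r (^-monoˡ-≤ k 0≤q q≤p)) p^kr≤1)))

fromℕ : ℕ → ℚ
fromℕ k = k ×ℚ 1ℚ

fromℕ-+ : ∀ j k → fromℕ (j ℕ.+ k) ≡ fromℕ j + fromℕ k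
fromℕ-+ = ×-homo-+ 1ℚ

fromℕ-* : ∀ j k → fromℕ (j ℕ.* k) ≡ fromℕ j * fromℕ k
fromℕ-* = ×1-homo-*

0≤fromℕ : ∀ k → 0ℚ ≤ fromℕ k
0≤fromℕ zero    = ≤-refl
0≤fromℕ (suc k) = 0≤p+q 0≤1 (0≤fromℕ k)

fromℕ-mono-≤ : ∀ {j k} → j ℕ.≤ k → fromℕ j ≤ fromℕ k
fromℕ-mono-≤ {zero}  {k}     z≤n       = 0≤fromℕ k
fromℕ-mono-≤ {suc j} {suc k} (s≤s j≤k) = +-monoʳ-≤ 1ℚ (fromℕ-mono-≤ j≤k)

0<fromℕ : ∀ k .{{_ : ℕ.NonZero k}} → 0ℚ < fromℕ k
0<fromℕ (suc k) = +-mono-<-≤ 0<1 (0≤fromℕ k)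

bernoulli : ∀ {t} k → 0ℚ ≤ t → t ≤ 1ℚ → (1ℚ - t) ^ k * (1ℚ + fromℕ k * t) ≤ 1ℚ
bernoulli {t} zero    0≤t t≤1 = ≤-reflexive (trivial t)
  where
  trivial : ∀ x → 1ℚ * (1ℚ + 0ℚ * x) ≡ 1ℚ
  trivial = solve-∀ ℚ-ring
bernoulli {t} (suc k) 0≤t t≤1 = ≤-trans
  (≤-byDifference ((1ℚ - t) ^ k * (fromℕ (suc k) * t ²))
     (0≤p*q (0≤p^k k (p≤q⇒0≤q-p t≤1)) (0≤p*q (0≤fromℕ (suc k)) (0≤p² t)))
     (expand t ((1ℚ - t) ^ k) (fromℕ k)))
  (bernoulli k 0≤t t≤1)
  where
  expand : ∀ x r c → r * (1ℚ + c * x) - (1ℚ - x) * r * (1ℚ + (1ℚ + c) * x) ≡ r * ((1ℚ + c) * (x * x))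
  expand = solve-∀ ℚ-ring

toℚᵘ-fromℕ : ∀ k → toℚᵘ (fromℕ k) ≃ᵘ mkℚᵘ (ℤ.+ k) 0
toℚᵘ-fromℕ zero    = ℚᵘ.≃-refl
toℚᵘ-fromℕ (suc k) = ℚᵘ.≃-trans (toℚᵘ-homo-+ 1ℚ (fromℕ k))
  (ℚᵘ.≃-trans (ℚᵘ.+-congʳ ℚᵘ.1ℚᵘ (toℚᵘ-fromℕ k)) (*≡* (cong (λ z → (ℤ.+ 1 ℤ.+ z) ℤ.* ℤ.+ 1) (ℤ.*-identityʳ (ℤ.+ k)))))

oneOver-inverse : ∀ k → 1 ℕ.≤ k → oneOver k * fromℕ k ≡ 1ℚ
oneOver-inverse (suc k) _ = toℚᵘ-injective (ℚᵘ.≃-trans (toℚᵘ-homo-* (oneOver (suc k)) (fromℕ (suc k)))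
  (ℚᵘ.≃-trans (ℚᵘ.*-cong (toℚᵘ-fromℚᵘ (mkℚᵘ (ℤ.+ 1) k)) (toℚᵘ-fromℕ (suc k))) (*≡* integral)))
  where
  integral : (ℤ.+ 1 ℤ.* ℤ.+ suc k) ℤ.* ℤ.+ 1 ≡ ℤ.+ 1 ℤ.* ℤ.+ (suc k ℕ.* 1)
  integral = trans (ℤ.*-identityʳ _) (trans (ℤ.*-identityˡ _)
    (trans (cong ℤ.+_ (sym (ℕ.*-identityʳ (suc k)))) (sym (ℤ.*-identityˡ _))))

0≤oneOver : ∀ k → 0ℚ ≤ oneOver k
0≤oneOver zero    = ≤-refl
0≤oneOver (suc k) = nonNegative⁻¹ _ {{normalize-nonNeg 1 (suc k)}}

oneOver≤1 : ∀ k → oneOver k ≤ 1ℚ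
oneOver≤1 zero    = 0≤1
oneOver≤1 (suc k) = subst₂ _≤_ (*-identityʳ _) (oneOver-inverse (suc k) (s≤s z≤n))
  (*-monoˡ-≤-0≤ _ (0≤oneOver (suc k)) (fromℕ-mono-≤ (s≤s (z≤n {k}))))

half : ℚ
half = oneOver 2

half^n*two^n : ∀ n → half ^ n * two ^ n ≡ 1ℚ
half^n*two^n n = trans (sym (^-distrib-* half two n)) (1^n n)

Σ< : ℕ → (ℕ → ℚ) → ℚ
Σ< k f = sum {k} (λ i → f (toℕ i))

infix 5 Σ<
syntax Σ< k (λ j → e) = ∑[ j < k ] e

Σ-cong : ∀ k {f g : ℕ → ℚ} → (∀ j → f j ≡ g j) → Σ< k f ≡ Σ< k g
Σ-cong k f≗g = sum-cong-≗ {k} (λ i → f≗g (toℕ i))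

Σ-cong< : ∀ k {f g : ℕ → ℚ} → (∀ j → j ℕ.< k → f j ≡ g j) → Σ< k f ≡ Σ< k g
Σ-cong< zero    f≗g = refl
Σ-cong< (suc k) f≗g = cong₂ _+_ (f≗g 0 (s≤s z≤n)) (Σ-cong< k (λ j j<k → f≗g (suc j) (s≤s j<k)))

Σ-distrib-+ : ∀ k (f g : ℕ → ℚ) → ∑[ j < k ] (f j + g j) ≡ Σ< k f + Σ< k g
Σ-distrib-+ k f g = ∑-distrib-+ {k} (λ i → f (toℕ i)) (λ i → g (toℕ i))

Σ-distrib-- : ∀ k (f g : ℕ → ℚ) → ∑[ j < k ] (f j - g j) ≡ Σ< k f - Σ< k g
Σ-distrib-- zero    f g = refl
Σ-distrib-- (suc k) f g = trans (cong ((f 0 - g 0) +_) (Σ-distrib-- k (f ∘ suc) (g ∘ suc)))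
  (interchange (f 0) (g 0) (Σ< k (f ∘ suc)) (Σ< k (g ∘ suc)))
  where
  interchange : ∀ a b c d → a - b + (c - d) ≡ a + c - (b + d)
  interchange = solve-∀ ℚ-ring

*-distribˡ-Σ : ∀ k c (f : ℕ → ℚ) → c * Σ< k f ≡ ∑[ j < k ] (c * f j)
*-distribˡ-Σ k c f = *-distribˡ-sum {k} c (λ i → f (toℕ i))

Σ-const : ∀ k c → ∑[ j < k ] c ≡ fromℕ k * c
Σ-const k c = trans (sum-replicate k) (trans (cong (k ×ℚ_) (sym (*-identityˡ c))) (sym (×-assoc-* k 1ℚ c)))

Σ-mono-≤ : ∀ k {f g : ℕ → ℚ} → (∀ j → j ℕ.< k → f j ≤ g j) → Σ< k f ≤ Σ< k g
Σ-mono-≤ zero    f≤g = ≤-refl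
Σ-mono-≤ (suc k) f≤g = +-mono-≤ (f≤g 0 (s≤s z≤n)) (Σ-mono-≤ k (λ j j<k → f≤g (suc j) (s≤s j<k)))

0≤Σ : ∀ k {f : ℕ → ℚ} → (∀ j → 0ℚ ≤ f j) → 0ℚ ≤ Σ< k f
0≤Σ zero    0≤f = ≤-refl
0≤Σ (suc k) 0≤f = 0≤p+q (0≤f 0) (0≤Σ k (0≤f ∘ suc))

Σ-monoˡ-≤ : ∀ {j k} {f : ℕ → ℚ} → (∀ i → 0ℚ ≤ f i) → j ℕ.≤ k → Σ< j f ≤ Σ< k f
Σ-monoˡ-≤ {zero}  {k}     0≤f z≤n       = 0≤Σ k 0≤f
Σ-monoˡ-≤ {suc j} {suc k} {f} 0≤f (s≤s j≤k) = +-monoʳ-≤ (f 0) (Σ-monoˡ-≤ (0≤f ∘ suc) j≤k)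

term≤Σ : ∀ {k} {f : ℕ → ℚ} r → (∀ j → 0ℚ ≤ f j) → r ℕ.< k → f r ≤ Σ< k f
term≤Σ {suc k} {f} zero    0≤f _ = subst (_≤ Σ< (suc k) f) (+-identityʳ (f 0)) (+-monoʳ-≤ (f 0) (0≤Σ k (0≤f ∘ suc)))
term≤Σ {suc k} {f} (suc r) 0≤f (s≤s r<k) = subst (_≤ Σ< (suc k) f) (+-identityˡ (f (suc r)))
  (+-mono-≤ (0≤f 0) (term≤Σ r (0≤f ∘ suc) r<k))

Σ-snoc : ∀ k (f : ℕ → ℚ) → Σ< (suc k) f ≡ Σ< k f + f k
Σ-snoc zero    f = +-comm (f 0) 0ℚ
Σ-snoc (suc k) f = trans (cong (f 0 +_) (Σ-snoc k (f ∘ suc))) (sym (+-assoc (f 0) _ (f (suc k))))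

Periodic : ℕ → (ℕ → ℚ) → Set
Periodic k f = ∀ j → f (k ℕ.+ j) ≡ f j

Σ-rotate : ∀ k (f : ℕ → ℚ) → Periodic k f → Σ< k (f ∘ suc) ≡ Σ< k f
Σ-rotate k f periodic = +-cancelˡ (f 0) (Σ< k (f ∘ suc)) (Σ< k f) (begin
  f 0 + Σ< k (f ∘ suc) ≡⟨ Σ-snoc k f ⟩
  Σ< k f + f k         ≡⟨ cong (Σ< k f +_) (trans (cong f (sym (ℕ.+-identityʳ k))) (periodic 0)) ⟩
  Σ< k f + f 0         ≡⟨ +-comm (Σ< k f) (f 0) ⟩
  f 0 + Σ< k f         ∎)
  where open ≡-Reasoning

Σ-window : ∀ k (f : ℕ → ℚ) → Periodic k f → ∀ r → ∑[ j < k ] f (r ℕ.+ j) ≡ Σ< k f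
Σ-window k f periodic zero    = refl
Σ-window k f periodic (suc r) = begin
  ∑[ j < k ] f (suc r ℕ.+ j) ≡⟨ Σ-cong k (λ j → cong f (sym (ℕ.+-suc r j))) ⟩
  ∑[ j < k ] f (r ℕ.+ suc j) ≡⟨ Σ-rotate k (λ j → f (r ℕ.+ j)) periodicʳ ⟩
  ∑[ j < k ] f (r ℕ.+ j)     ≡⟨ Σ-window k f periodic r ⟩
  Σ< k f                     ∎
  where
  periodicʳ : Periodic k (λ j → f (r ℕ.+ j))
  periodicʳ j = trans (cong f (swap r k j)) (periodic (r ℕ.+ j))
    where
    swap : ∀ a b c → a ℕ.+ (b ℕ.+ c) ≡ b ℕ.+ (a ℕ.+ c)
    swap = ℕ-solve-∀
  open ≡-Reasoning

Σ-telescope : ∀ r (f : ℕ → ℚ) → ∑[ j < r ] (f j - f (suc j)) ≡ f 0 - f r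
Σ-telescope zero    f = sym (+-inverseʳ (f 0))
Σ-telescope (suc r) f = trans (cong ((f 0 - f 1) +_) (Σ-telescope r (f ∘ suc))) (chain (f 0) (f 1) (f (suc r)))
  where
  chain : ∀ a b c → (a - b) + (b - c) ≡ a - c
  chain = solve-∀ ℚ-ring

Σ-alternating : ∀ k (w : ℕ → ℚ) → ∑[ j < k ] ((- 1ℚ) ^ j * (w j + w (suc j))) ≡ w 0 - (- 1ℚ) ^ k * w k
Σ-alternating zero    w = base (w 0)
  where
  base : ∀ a → 0ℚ ≡ a - 1ℚ * a
  base = solve-∀ ℚ-ring
Σ-alternating (suc k) w = begin
  1ℚ * (w 0 + w 1) + (∑[ j < k ] (- 1ℚ) * (- 1ℚ) ^ j * (w (suc j) + w (suc (suc j))))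
    ≡⟨ cong (1ℚ * (w 0 + w 1) +_) (trans (Σ-cong k (λ j → *-assoc (- 1ℚ) ((- 1ℚ) ^ j) (w (suc j) + w (suc (suc j)))))
      (sym (*-distribˡ-Σ k (- 1ℚ) (λ j → (- 1ℚ) ^ j * (w (suc j) + w (suc (suc j))))))) ⟩
  1ℚ * (w 0 + w 1) + (- 1ℚ) * (∑[ j < k ] (- 1ℚ) ^ j * (w (suc j) + w (suc (suc j))))
    ≡⟨ cong (λ s → 1ℚ * (w 0 + w 1) + (- 1ℚ) * s) (Σ-alternating k (w ∘ suc)) ⟩
  1ℚ * (w 0 + w 1) + (- 1ℚ) * (w 1 - (- 1ℚ) ^ k * w (suc k))
    ≡⟨ regroup (w 0) (w 1) ((- 1ℚ) ^ k) (w (suc k)) ⟩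
  w 0 - (- 1ℚ) * (- 1ℚ) ^ k * w (suc k) ∎
  where
  open ≡-Reasoning
  regroup : ∀ a b s c → 1ℚ * (a + b) + (- 1ℚ) * (b - s * c) ≡ a - (- 1ℚ) * s * c
  regroup = solve-∀ ℚ-ring

[-1]^j² : ∀ j → ((- 1ℚ) ^ j) ² ≡ 1ℚ
[-1]^j² zero    = refl
[-1]^j² (suc j) = trans (negate² ((- 1ℚ) ^ j)) ([-1]^j² j)
  where
  negate² : ∀ a → (- 1ℚ) * a * ((- 1ℚ) * a) ≡ a * a
  negate² = solve-∀ ℚ-ring

[-1]^odd : ∀ h → (- 1ℚ) ^ suc (h ℕ.+ h) ≡ - 1ℚ
[-1]^odd h = begin
  (- 1ℚ) * (- 1ℚ) ^ (h ℕ.+ h) ≡⟨ cong ((- 1ℚ) *_) (^-homo-* (- 1ℚ) h h) ⟩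
  (- 1ℚ) * ((- 1ℚ) ^ h) ²     ≡⟨ cong ((- 1ℚ) *_) ([-1]^j² h) ⟩
  (- 1ℚ) * 1ℚ                 ≡⟨ *-identityʳ (- 1ℚ) ⟩
  - 1ℚ                        ∎
  where open ≡-Reasoning

-- Dispersion

-- k² times the variance of f 0, …, f (k − 1).
dispersion : ℕ → (ℕ → ℚ) → ℚ
dispersion k f = fromℕ k * (∑[ j < k ] f j ²) - Σ< k f ²

dispersion-cong : ∀ k {f g : ℕ → ℚ} → (∀ j → f j ≡ g j) → dispersion k f ≡ dispersion k g
dispersion-cong k f≗g = cong₂ (λ e t → fromℕ k * e - t ²) (Σ-cong k (cong _² ∘ f≗g)) (Σ-cong k f≗g)

Σ-sq-affine : ∀ k (f : ℕ → ℚ) a b →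
  fromℕ k * (∑[ j < k ] (a * f j - b) ²) ≡ a ² * dispersion k f + (a * Σ< k f - fromℕ k * b) ²
Σ-sq-affine k f a b = begin
  fromℕ k * (∑[ j < k ] (a * f j - b) ²)
    ≡⟨ cong (fromℕ k *_) (Σ-cong k (λ j → expand a b (f j))) ⟩
  fromℕ k * (∑[ j < k ] (a ² * f j ² + c * f j + b ²))
    ≡⟨ cong (fromℕ k *_) (trans (Σ-distrib-+ k (λ j → a ² * f j ² + c * f j) (λ _ → b ²))
                                (cong₂ _+_ (Σ-distrib-+ k (λ j → a ² * f j ²) (λ j → c * f j)) (Σ-const k (b ²)))) ⟩
  fromℕ k * ((∑[ j < k ] (a ² * f j ²)) + (∑[ j < k ] (c * f j)) + fromℕ k * b ²)
    ≡⟨ cong (λ s → fromℕ k * (s + fromℕ k * b ²))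
            (sym (cong₂ _+_ (*-distribˡ-Σ k (a ²) (λ j → f j ²)) (*-distribˡ-Σ k c f))) ⟩
  fromℕ k * (a ² * (∑[ j < k ] f j ²) + c * Σ< k f + fromℕ k * b ²)
    ≡⟨ regroup (fromℕ k) a b (∑[ j < k ] f j ²) (Σ< k f) ⟩
  a ² * dispersion k f + (a * Σ< k f - fromℕ k * b) ² ∎
  where
  open ≡-Reasoning
  c = - (two * a * b)
  expand : ∀ a b x → (a * x - b) * (a * x - b) ≡ a * a * (x * x) + (- ((1ℚ + 1ℚ) * a * b)) * x + b * b
  expand = solve-∀ ℚ-ring
  regroup : ∀ K a b S₂ S₁ → K * (a * a * S₂ + (- ((1ℚ + 1ℚ) * a * b)) * S₁ + K * (b * b))
                          ≡ a * a * (K * S₂ - S₁ * S₁) + (a * S₁ - K * b) * (a * S₁ - K * b)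
  regroup = solve-∀ ℚ-ring

Σ-sq-centred : ∀ k (f : ℕ → ℚ) c → Σ< k f ≡ c →
  fromℕ k * (∑[ j < k ] (fromℕ k * f j - c) ²) ≡ fromℕ k ² * dispersion k f
Σ-sq-centred k f c Σf≡c = begin
  fromℕ k * (∑[ j < k ] (fromℕ k * f j - c) ²)                    ≡⟨ Σ-sq-affine k f (fromℕ k) c ⟩
  fromℕ k ² * dispersion k f + (fromℕ k * Σ< k f - fromℕ k * c) ² ≡⟨ cong (λ s → fromℕ k ² * dispersion k f + (fromℕ k * s - fromℕ k * c) ²) Σf≡c ⟩
  fromℕ k ² * dispersion k f + (fromℕ k * c - fromℕ k * c) ²      ≡⟨ cong (λ s → fromℕ k ² * dispersion k f + s ²) (+-inverseʳ (fromℕ k * c)) ⟩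
  fromℕ k ² * dispersion k f + 0ℚ                                 ≡⟨ +-identityʳ _ ⟩
  fromℕ k ² * dispersion k f                                      ∎
  where open ≡-Reasoning

0≤dispersion : ∀ k f → 0ℚ ≤ dispersion k f
0≤dispersion zero    f = ≤-refl
0≤dispersion (suc k) f = *-cancelˡ-≤-pos (K ²) {{positive (0<p*q (0<fromℕ (suc k)) (0<fromℕ (suc k)))}} (begin
  K ² * 0ℚ                             ≡⟨ *-zeroʳ (K ²) ⟩
  0ℚ                                   ≤⟨ 0≤p*q (0≤fromℕ (suc k)) (0≤Σ (suc k) (λ j → 0≤p² (K * f j - S))) ⟩
  K * (∑[ j < suc k ] (K * f j - S) ²) ≡⟨ Σ-sq-centred (suc k) f S refl ⟩
  K ² * dispersion (suc k) f           ∎)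
  where
  open ≤-Reasoning
  K = fromℕ (suc k)
  S = Σ< (suc k) f

cauchy-schwarz : ∀ k (f : ℕ → ℚ) → Σ< k f ² ≤ fromℕ k * (∑[ j < k ] f j ²)
cauchy-schwarz k f = 0≤q-p⇒p≤q (0≤dispersion k f)

dispersion≤Σ-sq-around : ∀ k (f : ℕ → ℚ) b → dispersion k f ≤ fromℕ k * (∑[ j < k ] (f j - b) ²)
dispersion≤Σ-sq-around k f b = begin
  dispersion k f                                        ≡⟨ sym (*-identityˡ (dispersion k f)) ⟩
  1ℚ ² * dispersion k f                                 ≤⟨ p≤p+q (0≤p² (1ℚ * Σ< k f - fromℕ k * b)) ⟩
  1ℚ ² * dispersion k f + (1ℚ * Σ< k f - fromℕ k * b) ² ≡⟨ sym (Σ-sq-affine k f 1ℚ b) ⟩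
  fromℕ k * (∑[ j < k ] (1ℚ * f j - b) ²)               ≡⟨ cong (fromℕ k *_) (Σ-cong k (λ j → cong (λ x → (x - b) ²) (*-identityˡ (f j)))) ⟩
  fromℕ k * (∑[ j < k ] (f j - b) ²)                    ∎
  where open ≤-Reasoning

dispersion≤Σ-sq-differences : ∀ k (f : ℕ → ℚ) →
  dispersion k f ≤ fromℕ k * (fromℕ k * (fromℕ k * (∑[ j < k ] (f j - f (suc j)) ²)))
dispersion≤Σ-sq-differences k f = ≤-trans (dispersion≤Σ-sq-around k f (f 0))
  (*-monoˡ-≤-0≤ (fromℕ k) (0≤fromℕ k)
    (subst (Σ< k (λ r → (f r - f 0) ²) ≤_) (Σ-const k (fromℕ k * Δ))
      (Σ-mono-≤ k (λ r r<k → distance≤ r (ℕ.<⇒≤ r<k)))))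
  where
  Δ = ∑[ j < k ] (f j - f (suc j)) ²
  0≤Δ : ∀ j → 0ℚ ≤ (f j - f (suc j)) ²
  0≤Δ j = 0≤p² (f j - f (suc j))
  distance≤ : ∀ r → r ℕ.≤ k → (f r - f 0) ² ≤ fromℕ k * Δ
  distance≤ r r≤k = begin
    (f r - f 0) ²                              ≡⟨ flip (f r) (f 0) ⟩
    (f 0 - f r) ²                              ≡⟨ cong _² (sym (Σ-telescope r f)) ⟩
    (∑[ j < r ] (f j - f (suc j))) ²           ≤⟨ cauchy-schwarz r (λ j → f j - f (suc j)) ⟩
    fromℕ r * (∑[ j < r ] (f j - f (suc j)) ²) ≤⟨ *-mono-≤-nonNeg (0≤fromℕ r) (0≤Σ r 0≤Δ) (fromℕ-mono-≤ r≤k) (Σ-monoˡ-≤ 0≤Δ r≤k) ⟩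
    fromℕ k * Δ                                ∎
    where
    open ≤-Reasoning
    flip : ∀ a b → (a - b) * (a - b) ≡ (b - a) * (b - a)
    flip = solve-∀ ℚ-ring

addShift subShift : (ℕ → ℚ) → ℕ → ℚ
addShift v j = v j + v (suc j)
subShift v j = v j - v (suc j)

module _ (k : ℕ) (v : ℕ → ℚ) (periodic : Periodic k v) where

  Σ-addShift : Σ< k (addShift v) ≡ Σ< k v + Σ< k v
  Σ-addShift = trans (Σ-distrib-+ k v (v ∘ suc)) (cong (Σ< k v +_) (Σ-rotate k v periodic))

  Σ-subShift : Σ< k (subShift v) ≡ 0ℚ
  Σ-subShift = trans (Σ-distrib-- k v (v ∘ suc)) (trans (cong (λ s → Σ< k v - s) (Σ-rotate k v periodic)) (+-inverseʳ (Σ< k v)))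

  parallelogram : (∑[ j < k ] addShift v j ²) + (∑[ j < k ] subShift v j ²) ≡ four * (∑[ j < k ] v j ²)
  parallelogram = begin
    (∑[ j < k ] addShift v j ²) + (∑[ j < k ] subShift v j ²) ≡⟨ sym (Σ-distrib-+ k (λ j → addShift v j ²) (λ j → subShift v j ²)) ⟩
    ∑[ j < k ] addShift v j ² + subShift v j ²                ≡⟨ Σ-cong k (λ j → identity (v j) (v (suc j))) ⟩
    ∑[ j < k ] two * v j ² + two * v (suc j) ²                ≡⟨ Σ-distrib-+ k (λ j → two * v j ²) (λ j → two * v (suc j) ²) ⟩
    (∑[ j < k ] two * v j ²) + (∑[ j < k ] two * v (suc j) ²) ≡⟨ sym (cong₂ _+_ (*-distribˡ-Σ k two (λ j → v j ²)) (*-distribˡ-Σ k two (λ j → v (suc j) ²))) ⟩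
    two * E + two * (∑[ j < k ] v (suc j) ²)                  ≡⟨ cong (λ s → two * E + two * s) (Σ-rotate k (λ j → v j ²) (λ j → cong _² (periodic j))) ⟩
    two * E + two * E                                         ≡⟨ double E ⟩
    four * E                                                  ∎
    where
    open ≡-Reasoning
    E = ∑[ j < k ] v j ²
    identity : ∀ a b → (a + b) * (a + b) + (a - b) * (a - b) ≡ (1ℚ + 1ℚ) * (a * a) + (1ℚ + 1ℚ) * (b * b)
    identity = solve-∀ ℚ-ring
    double : ∀ e → (1ℚ + 1ℚ) * e + (1ℚ + 1ℚ) * e ≡ ((1ℚ + 1ℚ) + (1ℚ + 1ℚ)) * e
    double = solve-∀ ℚ-ring

  private
    T = Σ< k v
    E = ∑[ j < k ] v j ²
    E⁺ = ∑[ j < k ] addShift v j ²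
    E⁻ = ∑[ j < k ] subShift v j ²
    K = fromℕ k

  dispersion-addShift : dispersion k (addShift v) ≡ four * dispersion k v - K * E⁻
  dispersion-addShift = begin
    K * E⁺ - Σ< k (addShift v) ²    ≡⟨ cong (λ s → K * E⁺ - s ²) Σ-addShift ⟩
    K * E⁺ - (T + T) ²              ≡⟨ cong (λ e → K * e - (T + T) ²) (trans (isolate E⁺ E⁻) (cong (_- E⁻) parallelogram)) ⟩
    K * (four * E - E⁻) - (T + T) ² ≡⟨ regroup K E E⁻ T ⟩
    four * (K * E - T ²) - K * E⁻   ∎
    where
    open ≡-Reasoning
    isolate : ∀ x y → x ≡ x + y - y
    isolate = solve-∀ ℚ-ring
    regroup : ∀ K E F T → K * (((1ℚ + 1ℚ) + (1ℚ + 1ℚ)) * E - F) - (T + T) * (T + T)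
                        ≡ ((1ℚ + 1ℚ) + (1ℚ + 1ℚ)) * (K * E - T * T) - K * F
    regroup = solve-∀ ℚ-ring

  dispersion-subShift : dispersion k (subShift v) ≡ four * dispersion k v - dispersion k (addShift v)
  dispersion-subShift = begin
    K * E⁻ - Σ< k (subShift v) ²                          ≡⟨ cong (λ s → K * E⁻ - s ²) Σ-subShift ⟩
    K * E⁻ - 0ℚ ²                                         ≡⟨ cong (λ e → K * e - 0ℚ ²) E⁻≡4E-E⁺ ⟩
    K * (four * E - E⁺) - 0ℚ ²                            ≡⟨ regroup K E E⁺ T ⟩
    four * (K * E - T ²) - (K * E⁺ - (T + T) ²)           ≡⟨ cong (λ s → four * (K * E - T ²) - (K * E⁺ - s ²)) (sym Σ-addShift) ⟩
    four * (K * E - T ²) - (K * E⁺ - Σ< k (addShift v) ²) ∎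
    where
    open ≡-Reasoning
    isolate : ∀ x y → x ≡ x + y - y
    isolate = solve-∀ ℚ-ring
    E⁻≡4E-E⁺ : E⁻ ≡ four * E - E⁺
    E⁻≡4E-E⁺ = trans (isolate E⁻ E⁺) (cong (_- E⁺) (trans (+-comm E⁻ E⁺) parallelogram))
    regroup : ∀ K E F T → K * (((1ℚ + 1ℚ) + (1ℚ + 1ℚ)) * E - F) - 0ℚ * 0ℚ
                        ≡ ((1ℚ + 1ℚ) + (1ℚ + 1ℚ)) * (K * E - T * T) - (K * F - (T + T) * (T + T))
    regroup = solve-∀ ℚ-ring

  contraction-addShift : K ² * dispersion k (addShift v) ≤ (four * K ² - 1ℚ) * dispersion k v
  contraction-addShift = ≤-byDifference (K * (K * (K * E⁻)) - dispersion k v)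
    (p≤q⇒0≤q-p (dispersion≤Σ-sq-differences k v))
    (trans (cong (λ d → (four * K ² - 1ℚ) * dispersion k v - K ² * d) dispersion-addShift)
           (regroup K (dispersion k v) E⁻))
    where
    regroup : ∀ K D F → (((1ℚ + 1ℚ) + (1ℚ + 1ℚ)) * (K * K) - 1ℚ) * D - K * K * (((1ℚ + 1ℚ) + (1ℚ + 1ℚ)) * D - K * F)
                      ≡ K * (K * (K * F)) - D
    regroup = solve-∀ ℚ-ring

-- Character sums over the cube, split by weight class

Σ-list : ∀ {A : Set} → (A → ℚ) → List A → ℚ
Σ-list g = List.foldr (λ x acc → g x + acc) 0ℚ

module _ {A : Set} where

  Σ-list-++ : ∀ (g : A → ℚ) xs ys → Σ-list g (xs List.++ ys) ≡ Σ-list g xs + Σ-list g ys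
  Σ-list-++ g []       ys = sym (+-identityˡ _)
  Σ-list-++ g (x ∷ xs) ys = trans (cong (g x +_) (Σ-list-++ g xs ys)) (sym (+-assoc (g x) _ _))

  Σ-list-map : ∀ {B : Set} (g : A → ℚ) (f : B → A) xs → Σ-list g (List.map f xs) ≡ Σ-list (g ∘ f) xs
  Σ-list-map g f []       = refl
  Σ-list-map g f (x ∷ xs) = cong (g (f x) +_) (Σ-list-map g f xs)

  Σ-list-cong : ∀ {g g′ : A → ℚ} xs → (∀ x → g x ≡ g′ x) → Σ-list g xs ≡ Σ-list g′ xs
  Σ-list-cong []       g≗g′ = refl
  Σ-list-cong (x ∷ xs) g≗g′ = cong₂ _+_ (g≗g′ x) (Σ-list-cong xs g≗g′)

  Σ-list-+ : ∀ (g g′ : A → ℚ) xs → Σ-list (λ x → g x + g′ x) xs ≡ Σ-list g xs + Σ-list g′ xs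
  Σ-list-+ g g′ []       = sym (+-identityˡ 0ℚ)
  Σ-list-+ g g′ (x ∷ xs) = trans (cong (g x + g′ x +_) (Σ-list-+ g g′ xs)) (interchange (g x) (g′ x) _ _)
    where
    interchange : ∀ a b c d → a + b + (c + d) ≡ a + c + (b + d)
    interchange = solve-∀ ℚ-ring

  *-distribˡ-Σ-list : ∀ c (g : A → ℚ) xs → c * Σ-list g xs ≡ Σ-list (λ x → c * g x) xs
  *-distribˡ-Σ-list c g []       = *-zeroʳ c
  *-distribˡ-Σ-list c g (x ∷ xs) = trans (*-distribˡ-+ c (g x) _) (cong (c * g x +_) (*-distribˡ-Σ-list c g xs))

sumℚ-cong : ∀ {n} {g g′ : Bits n → ℚ} → (∀ x → g x ≡ g′ x) → sumℚ g ≡ sumℚ g′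
sumℚ-cong {n} = Σ-list-cong (allBits n)

sumℚ-+ : ∀ {n} (g g′ : Bits n → ℚ) → sumℚ (λ x → g x + g′ x) ≡ sumℚ g + sumℚ g′
sumℚ-+ {n} g g′ = Σ-list-+ g g′ (allBits n)

*-distribˡ-sumℚ : ∀ {n} c (g : Bits n → ℚ) → c * sumℚ g ≡ sumℚ (λ x → c * g x)
*-distribˡ-sumℚ {n} c g = *-distribˡ-Σ-list c g (allBits n)

sumℚ-split : ∀ {n} (g : Bits (suc n) → ℚ) → sumℚ g ≡ sumℚ (g ∘ (false ∷_)) + sumℚ (g ∘ (true ∷_))
sumℚ-split {n} g = trans (Σ-list-++ g (List.map (false ∷_) (allBits n)) (List.map (true ∷_) (allBits n)))
  (cong₂ _+_ (Σ-list-map g (false ∷_) (allBits n)) (Σ-list-map g (true ∷_) (allBits n)))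

sumℚ-const : ∀ n c → sumℚ {n} (λ _ → c) ≡ two ^ n * c
sumℚ-const zero    c = trans (+-identityʳ c) (sym (*-identityˡ c))
sumℚ-const (suc n) c = trans (sumℚ-split {n} (λ _ → c)) (trans (cong₂ _+_ (sumℚ-const n c) (sumℚ-const n c)) (double (two ^ n) c))
  where
  double : ∀ p c → p * c + p * c ≡ (1ℚ + 1ℚ) * p * c
  double = solve-∀ ℚ-ring

charSum : ∀ {n} → Vec Bool n → (ℕ → ℚ) → ℚ
charSum S g = sumℚ (λ x → g (weight x) * sign (parity S x))

charSum-cong : ∀ {n} (S : Vec Bool n) {g g′ : ℕ → ℚ} → (∀ w → g w ≡ g′ w) → charSum S g ≡ charSum S g′
charSum-cong S g≗g′ = sumℚ-cong (λ x → cong (_* sign (parity S x)) (g≗g′ (weight x)))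

charSum-step : ∀ {n} b (S : Vec Bool n) g → charSum (b ∷ S) g ≡ charSum S g + sign b * charSum S (g ∘ suc)
charSum-step false S g = trans (sumℚ-split (λ x → g (weight x) * sign (parity (false ∷ S) x)))
  (cong (charSum S g +_) (sym (*-identityˡ _)))
charSum-step true S g = trans (sumℚ-split (λ x → g (weight x) * sign (parity (true ∷ S) x)))
  (cong (charSum S g +_) (trans (sumℚ-cong (λ x → flip (g (suc (weight x))) (parity S x)))
                                (sym (*-distribˡ-sumℚ (- 1ℚ) (λ x → g (suc (weight x)) * sign (parity S x))))))
  where
  flip : ∀ a p → a * sign (not p) ≡ - 1ℚ * (a * sign p)
  flip a false = flip₁ a
    where
    flip₁ : ∀ a → a * - 1ℚ ≡ - 1ℚ * (a * 1ℚ)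
    flip₁ = solve-∀ ℚ-ring
  flip a true  = flip₂ a
    where
    flip₂ : ∀ a → a * 1ℚ ≡ - 1ℚ * (a * - 1ℚ)
    flip₂ = solve-∀ ℚ-ring

charSum-const-nonempty : ∀ {n} (S : Vec Bool n) c → Nonempty S → charSum S (λ _ → c) ≡ 0ℚ
charSum-const-nonempty (true ∷ S) c _ = trans (charSum-step true S (λ _ → c)) (cancel (charSum S (λ _ → c)))
  where
  cancel : ∀ x → x + - 1ℚ * x ≡ 0ℚ
  cancel = solve-∀ ℚ-ring
charSum-const-nonempty (false ∷ S) c (Fin.suc i , Sᵢ≡true) =
  trans (charSum-step false S (λ _ → c)) (cong₂ (λ x y → x + 1ℚ * y) vanishes vanishes)
  where
  vanishes = charSum-const-nonempty S c (i , Sᵢ≡true)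

𝟙 : Bool → ℚ
𝟙 b = if b then 1ℚ else 0ℚ

𝟙² : ∀ b → 𝟙 b ² ≡ 𝟙 b
𝟙² false = refl
𝟙² true  = refl

0≤𝟙 : ∀ b → 0ℚ ≤ 𝟙 b
0≤𝟙 false = ≤-refl
0≤𝟙 true  = 0≤1

𝟙*p>0⇒true : ∀ b {p} → 0ℚ < 𝟙 b * p → b ≡ true
𝟙*p>0⇒true true  _ = refl
𝟙*p>0⇒true false {p} 0<0*p = ⊥-elim (<-irrefl refl (subst (0ℚ <_) (*-zeroˡ p) 0<0*p))

if-∨ : ∀ a b c → (a ≡ true → b ≡ false) → (if a ∨ b then c else 0ℚ) ≡ c * (𝟙 a + 𝟙 b)
if-∨ true  true  c exclusive with exclusive refl
... | ()
if-∨ true  false c _ = sym (trans (cong (c *_) (+-identityʳ 1ℚ)) (*-identityʳ c))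
if-∨ false true  c _ = sym (trans (cong (c *_) (+-identityˡ 1ℚ)) (*-identityʳ c))
if-∨ false false c _ = sym (*-zeroʳ c)

inClass : ℕ → ℕ → ℕ → Bool
inClass M r w = does (M ∣? w ℕ.+ r)

classSums : ∀ {n} → ℕ → Vec Bool n → ℕ → ℚ
classSums M S r = charSum S (λ w → 𝟙 (inClass M r w))

classSums-[] : ∀ M r → classSums M [] r ≡ 𝟙 (inClass M r 0)
classSums-[] M r = trans (+-identityʳ _) (*-identityʳ _)

classSums-step : ∀ {n} M b (S : Vec Bool n) r → classSums M (b ∷ S) r ≡ classSums M S r + sign b * classSums M S (suc r)
classSums-step M b S r = trans (charSum-step b S (λ w → 𝟙 (inClass M r w)))
  (cong (λ s → classSums M S r + sign b * s) (charSum-cong S (λ w → cong (λ i → 𝟙 (does (M ∣? i))) (sym (ℕ.+-suc w r)))))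

classSums-false : ∀ {n} M (S : Vec Bool n) r → classSums M (false ∷ S) r ≡ addShift (classSums M S) r
classSums-false M S r = trans (classSums-step M false S r) (cong (classSums M S r +_) (*-identityˡ _))

classSums-true : ∀ {n} M (S : Vec Bool n) r → classSums M (true ∷ S) r ≡ subShift (classSums M S) r
classSums-true M S r = trans (classSums-step M true S r) (negate (classSums M S r) (classSums M S (suc r)))
  where
  negate : ∀ a b → a + - 1ℚ * b ≡ a - b
  negate = solve-∀ ℚ-ring

classSums-periodic : ∀ {n} M (S : Vec Bool n) → Periodic M (classSums M S)
classSums-periodic M S r = charSum-cong S (λ w → cong 𝟙 (does-⇔ (shiftByM w) (M ∣? w ℕ.+ (M ℕ.+ r)) (M ∣? w ℕ.+ r)))
  where
  shiftByM : ∀ w → M ∣ w ℕ.+ (M ℕ.+ r) ⇔ M ∣ w ℕ.+ r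
  shiftByM w = mk⇔ (λ M∣ → ∣m+n∣m⇒∣n (subst (M ∣_) (rearrange w M r) M∣) ∣-refl)
                   (λ M∣ → subst (M ∣_) (sym (rearrange w M r)) (∣m∣n⇒∣m+n ∣-refl M∣))
    where
    rearrange : ∀ w M r → w ℕ.+ (M ℕ.+ r) ≡ M ℕ.+ (w ℕ.+ r)
    rearrange = ℕ-solve-∀

Σ-classSums-nonempty : ∀ {n} M (S : Vec Bool n) → Nonempty S → Σ< M (classSums M S) ≡ 0ℚ
Σ-classSums-nonempty M (true ∷ S) _ =
  trans (Σ-cong M (classSums-true M S)) (Σ-subShift M (classSums M S) (classSums-periodic M S))
Σ-classSums-nonempty M (false ∷ S) (Fin.suc i , Sᵢ≡true) = begin
  Σ< M (classSums M (false ∷ S))              ≡⟨ Σ-cong M (classSums-false M S) ⟩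
  Σ< M (addShift (classSums M S))             ≡⟨ Σ-addShift M (classSums M S) (classSums-periodic M S) ⟩
  Σ< M (classSums M S) + Σ< M (classSums M S) ≡⟨ cong₂ _+_ vanishes vanishes ⟩
  0ℚ + 0ℚ                                     ≡⟨ +-identityʳ 0ℚ ⟩
  0ℚ                                          ∎
  where
  open ≡-Reasoning
  vanishes = Σ-classSums-nonempty M S (i , Sᵢ≡true)

-- Odd period: contraction of the dispersion

module OddPeriod (h : ℕ) where

  M : ℕ
  M = suc (h ℕ.+ h)

  0<M² : 0ℚ < fromℕ M ²
  0<M² = 0<p*q (0<fromℕ M) (0<fromℕ M)

  -- Since M is odd, twice u r is the alternating sum of addShift u over the window starting at r.
  Σ-sq≤Σ-sq-addShift : ∀ u → Periodic M u → ∑[ j < M ] u j ² ≤ fromℕ M * (fromℕ M * (∑[ j < M ] addShift u j ²))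
  Σ-sq≤Σ-sq-addShift u periodic =
    subst (Σ< M (λ r → u r ²) ≤_) (Σ-const M (fromℕ M * E⁺)) (Σ-mono-≤ M (λ r _ → u²≤ME⁺ r))
    where
    u⁺² : ℕ → ℚ
    u⁺² j = addShift u j ²
    E⁺ = Σ< M u⁺²
    periodic⁺² : Periodic M u⁺²
    periodic⁺² j = cong₂ (λ a b → (a + b) ²) (periodic j) (trans (cong u (sym (ℕ.+-suc M j))) (periodic (suc j)))
    double : ∀ r → ∑[ j < M ] (- 1ℚ) ^ j * (u (r ℕ.+ j) + u (r ℕ.+ suc j)) ≡ u r + u r
    double r = begin
      ∑[ j < M ] (- 1ℚ) ^ j * (u (r ℕ.+ j) + u (r ℕ.+ suc j)) ≡⟨ Σ-alternating M (λ j → u (r ℕ.+ j)) ⟩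
      u (r ℕ.+ 0) - (- 1ℚ) ^ M * u (r ℕ.+ M)                  ≡⟨ cong₂ (λ a b → u a - b * u (r ℕ.+ M)) (ℕ.+-identityʳ r) ([-1]^odd h) ⟩
      u r - (- 1ℚ) * u (r ℕ.+ M)                              ≡⟨ cong (λ a → u r - (- 1ℚ) * a) (trans (cong u (ℕ.+-comm r M)) (periodic r)) ⟩
      u r - (- 1ℚ) * u r                                      ≡⟨ minus-minus (u r) ⟩
      u r + u r                                               ∎
      where
      open ≡-Reasoning
      minus-minus : ∀ a → a - (- 1ℚ) * a ≡ a + a
      minus-minus = solve-∀ ℚ-ring
    u²≤ME⁺ : ∀ r → u r ² ≤ fromℕ M * E⁺
    u²≤ME⁺ r = begin
      u r ²                                                       ≤⟨ p≤p+q (0≤p*q (0≤p+q 0≤two 0≤1) (0≤p² (u r))) ⟩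
      u r ² + (two + 1ℚ) * u r ²                                  ≡⟨ quadruple (u r) ⟩
      (u r + u r) ²                                               ≡⟨ cong _² (sym (double r)) ⟩
      (∑[ j < M ] (- 1ℚ) ^ j * (u (r ℕ.+ j) + u (r ℕ.+ suc j))) ² ≤⟨ cauchy-schwarz M (λ j → (- 1ℚ) ^ j * (u (r ℕ.+ j) + u (r ℕ.+ suc j))) ⟩
      fromℕ M * (∑[ j < M ] ((- 1ℚ) ^ j * (u (r ℕ.+ j) + u (r ℕ.+ suc j))) ²)
        ≡⟨ cong (fromℕ M *_) (Σ-cong M (λ j → unsign ((- 1ℚ) ^ j) (u (r ℕ.+ j) + u (r ℕ.+ suc j)) ([-1]^j² j))) ⟩
      fromℕ M * (∑[ j < M ] (u (r ℕ.+ j) + u (r ℕ.+ suc j)) ²)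
        ≡⟨ cong (fromℕ M *_) (Σ-cong M (λ j → cong (λ i → (u (r ℕ.+ j) + u i) ²) (ℕ.+-suc r j))) ⟩
      fromℕ M * (∑[ j < M ] u⁺² (r ℕ.+ j))
        ≡⟨ cong (fromℕ M *_) (Σ-window M u⁺² periodic⁺² r) ⟩
      fromℕ M * E⁺                                                ∎
      where
      open ≤-Reasoning
      quadruple : ∀ a → a * a + ((1ℚ + 1ℚ) + 1ℚ) * (a * a) ≡ (a + a) * (a + a)
      quadruple = solve-∀ ℚ-ring
      unsign : ∀ s x → s * s ≡ 1ℚ → (s * x) * (s * x) ≡ x * x
      unsign s x s²≡1 = trans (rearrange s x) (trans (cong (_* (x * x)) s²≡1) (*-identityˡ (x * x)))
        where
        rearrange : ∀ s x → (s * x) * (s * x) ≡ (s * s) * (x * x)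
        rearrange = solve-∀ ℚ-ring

  dispersion≤dispersion-addShift : ∀ v → Periodic M v → dispersion M v ≤ fromℕ M ² * dispersion M (addShift v)
  dispersion≤dispersion-addShift v periodic = *-cancelˡ-≤-pos (fromℕ M ²) {{positive 0<M²}} (begin
    fromℕ M ² * dispersion M v   ≡⟨ sym (Σ-sq-centred M v T refl) ⟩
    fromℕ M * (∑[ j < M ] u j ²) ≤⟨ *-monoˡ-≤-0≤ (fromℕ M) (0≤fromℕ M) (Σ-sq≤Σ-sq-addShift u periodicᵘ) ⟩
    fromℕ M * (fromℕ M * (fromℕ M * (∑[ j < M ] addShift u j ²)))
      ≡⟨ cong (λ s → fromℕ M * (fromℕ M * (fromℕ M * s))) (Σ-cong M (λ j → cong _² (recentre (fromℕ M) T (v j) (v (suc j))))) ⟩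
    fromℕ M * (fromℕ M * (fromℕ M * (∑[ j < M ] (fromℕ M * addShift v j - (T + T)) ²)))
      ≡⟨ cong (λ s → fromℕ M * (fromℕ M * s)) (Σ-sq-centred M (addShift v) (T + T) (Σ-addShift M v periodic)) ⟩
    fromℕ M * (fromℕ M * (fromℕ M ² * dispersion M (addShift v)))
      ≡⟨ sym (*-assoc (fromℕ M) (fromℕ M) _) ⟩
    fromℕ M ² * (fromℕ M ² * dispersion M (addShift v)) ∎)
    where
    open ≤-Reasoning
    T = Σ< M v
    u : ℕ → ℚ
    u j = fromℕ M * v j - T
    periodicᵘ : Periodic M u
    periodicᵘ j = cong (λ x → fromℕ M * x - T) (periodic j)
    recentre : ∀ K T a b → K * a - T + (K * b - T) ≡ K * (a + b) - (T + T)
    recentre = solve-∀ ℚ-ring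

  contraction-subShift : ∀ v → Periodic M v →
    fromℕ M ² * dispersion M (subShift v) ≤ (four * fromℕ M ² - 1ℚ) * dispersion M v
  contraction-subShift v periodic = ≤-byDifference (fromℕ M ² * dispersion M (addShift v) - dispersion M v)
    (p≤q⇒0≤q-p (dispersion≤dispersion-addShift v periodic))
    (trans (cong (λ d → (four * fromℕ M ² - 1ℚ) * dispersion M v - fromℕ M ² * d) (dispersion-subShift M v periodic))
           (regroup (fromℕ M) (dispersion M v) (dispersion M (addShift v))))
    where
    regroup : ∀ K D D⁺ → (((1ℚ + 1ℚ) + (1ℚ + 1ℚ)) * (K * K) - 1ℚ) * D - K * K * (((1ℚ + 1ℚ) + (1ℚ + 1ℚ)) * D - D⁺)
                       ≡ K * K * D⁺ - D
    regroup = solve-∀ ℚ-ring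

  Q : ℕ
  Q = 4 ℕ.* (M ℕ.* M)

  ρ κ : ℚ
  ρ = 1ℚ - oneOver Q
  κ = four * ρ

  fromℕ-Q : fromℕ Q ≡ four * fromℕ M ²
  fromℕ-Q = trans (fromℕ-* 4 (M ℕ.* M)) (cong (four *_) (fromℕ-* M M))

  M²κ : fromℕ M ² * κ ≡ four * fromℕ M ² - 1ℚ
  M²κ = begin
    fromℕ M ² * (four * (1ℚ - q))           ≡⟨ distribute (fromℕ M) q ⟩
    four * fromℕ M ² - four * fromℕ M ² * q ≡⟨ cong (λ x → four * fromℕ M ² - x * q) (sym fromℕ-Q) ⟩
    four * fromℕ M ² - fromℕ Q * q          ≡⟨ cong (four * fromℕ M ² -_) (trans (*-comm (fromℕ Q) q) (oneOver-inverse Q (s≤s z≤n))) ⟩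
    four * fromℕ M ² - 1ℚ                   ∎
    where
    open ≡-Reasoning
    q = oneOver Q
    distribute : ∀ K q → K * K * (((1ℚ + 1ℚ) + (1ℚ + 1ℚ)) * (1ℚ - q))
                       ≡ ((1ℚ + 1ℚ) + (1ℚ + 1ℚ)) * (K * K) - ((1ℚ + 1ℚ) + (1ℚ + 1ℚ)) * (K * K) * q
    distribute = solve-∀ ℚ-ring

  κ-contraction : ∀ {d′ d} → fromℕ M ² * d′ ≤ (four * fromℕ M ² - 1ℚ) * d → d′ ≤ κ * d
  κ-contraction {d′} {d} M²d′≤ = *-cancelˡ-≤-pos (fromℕ M ²) {{positive 0<M²}}
    (subst (fromℕ M ² * d′ ≤_) (trans (cong (_* d) (sym M²κ)) (*-assoc (fromℕ M ²) κ d)) M²d′≤)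

  0≤ρ : 0ℚ ≤ ρ
  0≤ρ = p≤q⇒0≤q-p (oneOver≤1 Q)

  ρ≤1 : ρ ≤ 1ℚ
  ρ≤1 = ≤-byDifference (oneOver Q) (0≤oneOver Q) (cancel (oneOver Q))
    where
    cancel : ∀ t → 1ℚ - (1ℚ - t) ≡ t
    cancel = solve-∀ ℚ-ring

  ρ^Q*two≤1 : ρ ^ Q * two ≤ 1ℚ
  ρ^Q*two≤1 = subst (λ x → ρ ^ Q * (1ℚ + x) ≤ 1ℚ) (trans (*-comm (fromℕ Q) (oneOver Q)) (oneOver-inverse Q (s≤s z≤n)))
    (bernoulli Q (0≤oneOver Q) (oneOver≤1 Q))

  0≤κ : 0ℚ ≤ κ
  0≤κ = 0≤p*q 0≤four 0≤ρ

  Σ-initialClass : Σ< M (λ r → 𝟙 (inClass M r 0)) ≡ 1ℚ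
  Σ-initialClass = begin
    𝟙 (inClass M 0 0) + (∑[ j < h ℕ.+ h ] 𝟙 (inClass M (suc j) 0))
      ≡⟨ cong₂ _+_ (cong 𝟙 (dec-true (M ∣? 0) (M ∣0))) (Σ-cong< (h ℕ.+ h) (λ j j<2h → cong 𝟙 (dec-false (M ∣? suc j) (>⇒∤ (s≤s j<2h))))) ⟩
    1ℚ + (∑[ j < h ℕ.+ h ] 0ℚ) ≡⟨ cong (1ℚ +_) (trans (Σ-const (h ℕ.+ h) 0ℚ) (*-zeroʳ (fromℕ (h ℕ.+ h)))) ⟩
    1ℚ + 0ℚ                    ≡⟨ +-identityʳ 1ℚ ⟩
    1ℚ                         ∎
    where open ≡-Reasoning

  dispersion-initial : dispersion M (classSums M []) ≤ fromℕ M
  dispersion-initial = ≤-byDifference 1ℚ 0≤1 (begin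
    fromℕ M - (fromℕ M * (∑[ r < M ] classSums M [] r ²) - Σ< M (classSums M []) ²)
      ≡⟨ cong₂ (λ e t → fromℕ M - (fromℕ M * e - t ²))
           (trans (Σ-cong M (λ r → trans (cong _² (classSums-[] M r)) (𝟙² (inClass M r 0)))) Σ-initialClass)
           (trans (Σ-cong M (classSums-[] M)) Σ-initialClass) ⟩
    fromℕ M - (fromℕ M * 1ℚ - 1ℚ ²) ≡⟨ simplify (fromℕ M) ⟩
    1ℚ                              ∎)
    where
    open ≡-Reasoning
    simplify : ∀ K → K - (K * 1ℚ - 1ℚ * 1ℚ) ≡ 1ℚ
    simplify = solve-∀ ℚ-ring

  dispersion-step : ∀ {n} b (S : Vec Bool n) → dispersion M (classSums M (b ∷ S)) ≤ κ * dispersion M (classSums M S)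
  dispersion-step b S = κ-contraction (subst (λ d → fromℕ M ² * d ≤ (four * fromℕ M ² - 1ℚ) * dispersion M (classSums M S))
    (sym (dispersion-cong M (step b))) (contraction b))
    where
    step : ∀ b → ∀ r → classSums M (b ∷ S) r ≡ (if b then subShift else addShift) (classSums M S) r
    step false = classSums-false M S
    step true  = classSums-true M S
    contraction : ∀ b → fromℕ M ² * dispersion M ((if b then subShift else addShift) (classSums M S))
                          ≤ (four * fromℕ M ² - 1ℚ) * dispersion M (classSums M S)
    contraction false = contraction-addShift M (classSums M S) (classSums-periodic M S)
    contraction true  = contraction-subShift (classSums M S) (classSums-periodic M S)

  dispersion-classSums : ∀ {n} (S : Vec Bool n) → dispersion M (classSums M S) ≤ κ ^ n * fromℕ M
  dispersion-classSums [] = subst (dispersion M (classSums M []) ≤_) (sym (*-identityˡ (fromℕ M))) dispersion-initial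
  dispersion-classSums {suc n} (b ∷ S) = begin
    dispersion M (classSums M (b ∷ S)) ≤⟨ dispersion-step b S ⟩
    κ * dispersion M (classSums M S)   ≤⟨ *-monoˡ-≤-0≤ κ 0≤κ (dispersion-classSums S) ⟩
    κ * (κ ^ n * fromℕ M)              ≡⟨ sym (*-assoc κ (κ ^ n) (fromℕ M)) ⟩
    κ ^ suc n * fromℕ M                ∎
    where open ≤-Reasoning

  Σ-classSums-allFalse : ∀ n → Σ< M (classSums M (Vec.replicate n false)) ≡ two ^ n
  Σ-classSums-allFalse zero    = trans (Σ-cong M (classSums-[] M)) Σ-initialClass
  Σ-classSums-allFalse (suc n) = begin
    Σ< M (classSums M (false ∷ Vec.replicate n false))    ≡⟨ Σ-cong M (classSums-false M (Vec.replicate n false)) ⟩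
    Σ< M (addShift (classSums M (Vec.replicate n false))) ≡⟨ Σ-addShift M _ (classSums-periodic M (Vec.replicate n false)) ⟩
    T + T                                                 ≡⟨ cong₂ _+_ (Σ-classSums-allFalse n) (Σ-classSums-allFalse n) ⟩
    two ^ n + two ^ n                                     ≡⟨ double (two ^ n) ⟩
    two ^ suc n                                           ∎
    where
    open ≡-Reasoning
    T = Σ< M (classSums M (Vec.replicate n false))
    double : ∀ p → p + p ≡ (1ℚ + 1ℚ) * p
    double = solve-∀ ℚ-ring

  classSums-nonempty-bound : ∀ {n} (S : Vec Bool n) → Nonempty S → classSums M S 0 ² ≤ κ ^ n
  classSums-nonempty-bound {n} S nonempty = ≤-trans (term≤Σ {M} 0 (λ r → 0≤p² (classSums M S r)) (s≤s z≤n))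
    (*-cancelˡ-≤-pos (fromℕ M) {{positive (0<fromℕ M)}} (begin
      fromℕ M * E                  ≡⟨ sym (trans (cong (λ t → fromℕ M * E - t ²) (Σ-classSums-nonempty M S nonempty)) (+-identityʳ _)) ⟩
      dispersion M (classSums M S) ≤⟨ dispersion-classSums S ⟩
      κ ^ n * fromℕ M              ≡⟨ *-comm (κ ^ n) (fromℕ M) ⟩
      fromℕ M * κ ^ n              ∎))
    where
    open ≤-Reasoning
    E = ∑[ r < M ] classSums M S r ²

  classSums-allFalse-bound : ∀ n r → r ℕ.< M →
    (fromℕ M * classSums M (Vec.replicate n false) r - two ^ n) ² ≤ fromℕ M ² * κ ^ n
  classSums-allFalse-bound n r r<M = ≤-trans (term≤Σ {M} r (λ j → 0≤p² (fromℕ M * v j - two ^ n)) r<M)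
    (*-cancelˡ-≤-pos (fromℕ M) {{positive (0<fromℕ M)}} (begin
      fromℕ M * (∑[ j < M ] (fromℕ M * v j - two ^ n) ²) ≡⟨ Σ-sq-centred M v (two ^ n) (Σ-classSums-allFalse n) ⟩
      fromℕ M ² * dispersion M v                         ≤⟨ *-monoˡ-≤-0≤ (fromℕ M ²) (0≤p² (fromℕ M)) (dispersion-classSums (Vec.replicate n false)) ⟩
      fromℕ M ² * (κ ^ n * fromℕ M)                      ≡⟨ rotate (fromℕ M) (κ ^ n) ⟩
      fromℕ M * (fromℕ M ² * κ ^ n)                      ∎))
    where
    open ≤-Reasoning
    v = classSums M (Vec.replicate n false)
    rotate : ∀ K x → K * K * (x * K) ≡ K * (K * K * x)
    rotate = solve-∀ ℚ-ring

dec-true⁻¹ : ∀ {A : Set} (a? : Dec A) → does a? ≡ true → A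
dec-true⁻¹ (yes a) _ = a

no-multiple-between : ∀ {M a b} → M ∣ a → M ∣ b → a ℕ.< b → b ℕ.< a ℕ.+ M → ⊥
no-multiple-between {zero}  {a} _ _ a<b b<a+0 = ℕ.<-asym a<b (subst (_ ℕ.<_) (ℕ.+-identityʳ a) b<a+0)
no-multiple-between {suc k} {a} {b} M∣a M∣b a<b b<a+M =
  ℕ.<⇒≱ (ℕ.m<n+o⇒m∸n<o b a b<a+M) (∣⇒≤ {{ℕ.>-nonZero (ℕ.m<n⇒0<n∸m a<b)}} M∣b∸a)
  where
  M∣b∸a : suc k ∣ b ℕ.∸ a
  M∣b∸a = ∣m+n∣m⇒∣n (subst (suc k ∣_) (sym (ℕ.m+[n∸m]≡n (ℕ.<⇒≤ a<b))) M∣b) M∣a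

no-multiple-near : ∀ {M w y k r} → M ∣ w → w ℕ.≤ y ℕ.+ k → y ℕ.≤ w ℕ.+ k → k ℕ.< r → k ℕ.+ r ℕ.< M → ¬ M ∣ y ℕ.+ r
no-multiple-near {M} {w} {y} {k} {r} M∣w w≤y+k y≤w+k k<r k+r<M M∣y+r =
  no-multiple-between M∣w M∣y+r (ℕ.≤-<-trans w≤y+k (ℕ.+-monoʳ-< y k<r))
    (ℕ.≤-<-trans (ℕ.+-monoˡ-≤ r y≤w+k) (subst (ℕ._< w ℕ.+ M) (sym (ℕ.+-assoc w k r)) (ℕ.+-monoʳ-< w k+r<M)))

weight≡Σ : ∀ {n} (x : Bits n) → weight x ≡ ℕ-sum (λ i → if Vec.lookup x i then 1 else 0)
weight≡Σ []          = refl
weight≡Σ (true ∷ x)  = cong suc (weight≡Σ x)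
weight≡Σ (false ∷ x) = weight≡Σ x

weight-permute : ∀ {n} (π : Permutation′ n) (x : Bits n) → weight (permute π x) ≡ weight x
weight-permute {n} π x = begin
  weight (permute π x)                                      ≡⟨ weight≡Σ (permute π x) ⟩
  ℕ-sum (λ i → if Vec.lookup (permute π x) i then 1 else 0) ≡⟨ ℕ-sum-cong-≗ {n} (λ i → cong (λ b → if b then 1 else 0) (Vec.lookup∘tabulate (λ j → Vec.lookup x (π ⟨$⟩ʳ j)) i)) ⟩
  ℕ-sum (λ i → if Vec.lookup x (π ⟨$⟩ʳ i) then 1 else 0)    ≡⟨ sym (ℕ-sum-permute (λ i → if Vec.lookup x i then 1 else 0) π) ⟩
  ℕ-sum (λ i → if Vec.lookup x i then 1 else 0)             ≡⟨ sym (weight≡Σ x) ⟩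
  weight x                                                  ∎
  where open ≡-Reasoning

weight-⊕ : ∀ {n} (x z : Bits n) → weight (x ⊕ z) ℕ.≤ weight x ℕ.+ weight z
weight-⊕ []          []          = z≤n
weight-⊕ (false ∷ x) (false ∷ z) = weight-⊕ x z
weight-⊕ (false ∷ x) (true ∷ z)  = subst (suc (weight (x ⊕ z)) ℕ.≤_) (sym (ℕ.+-suc (weight x) (weight z))) (s≤s (weight-⊕ x z))
weight-⊕ (true ∷ x)  (false ∷ z) = s≤s (weight-⊕ x z)
weight-⊕ (true ∷ x)  (true ∷ z)  = ℕ.≤-trans (weight-⊕ x z) (ℕ.+-mono-≤ (ℕ.n≤1+n _) (ℕ.n≤1+n _))

⊕-involutive : ∀ {n} (x z : Bits n) → (x ⊕ z) ⊕ z ≡ x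
⊕-involutive []      []      = refl
⊕-involutive (a ∷ x) (c ∷ z) = cong₂ _∷_ (trans (xor-assoc a c c) (trans (cong (a xor_) (xor-same c)) (xor-identityʳ a)))
                                         (⊕-involutive x z)

parity-allFalse : ∀ {n} (x : Bits n) → parity (Vec.replicate n false) x ≡ false
parity-allFalse []      = refl
parity-allFalse (_ ∷ x) = parity-allFalse x

-- The construction

error-budget : ∀ {q K μ P} L → 0ℚ ≤ q → 0ℚ ≤ K → 0ℚ ≤ μ → 0ℚ ≤ P →
  K ^ L * P ≤ 1ℚ → K ≤ μ ^ 8 → q * μ ^ 6 ≤ 1ℚ → (q * K) ^ (4 ℕ.* L) * P ≤ 1ℚ
error-budget {q} {K} {μ} {P} L 0≤q 0≤K 0≤μ 0≤P K^LP≤1 K≤μ⁸ qμ⁶≤1 = begin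
  (q * K) ^ (4 ℕ.* L) * P           ≡⟨ cong (_* P) (trans (sym (^-assocʳ (q * K) 4 L)) (cong (_^ L) (split q K))) ⟩
  (q ^ 4 * K ^ 3 * K) ^ L * P       ≡⟨ trans (cong (_* P) (^-distrib-* (q ^ 4 * K ^ 3) K L)) (*-assoc ((q ^ 4 * K ^ 3) ^ L) (K ^ L) P) ⟩
  (q ^ 4 * K ^ 3) ^ L * (K ^ L * P) ≤⟨ p*q≤1 (0≤p^k L 0≤q⁴K³) (p^k≤1 L 0≤q⁴K³ q⁴K³≤1) (0≤p*q (0≤p^k L 0≤K) 0≤P) K^LP≤1 ⟩
  1ℚ                                ∎
  where
  open ≤-Reasoning
  0≤q⁴K³ = 0≤p*q (0≤p^k 4 0≤q) (0≤p^k 3 0≤K)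
  q⁴K³≤1 : q ^ 4 * K ^ 3 ≤ 1ℚ
  q⁴K³≤1 = begin
    q ^ 4 * K ^ 3       ≤⟨ *-monoˡ-≤-0≤ (q ^ 4) (0≤p^k 4 0≤q) (^-monoˡ-≤ 3 0≤K K≤μ⁸) ⟩
    q ^ 4 * (μ ^ 8) ^ 3 ≡⟨ cong (q ^ 4 *_) (trans (^-assocʳ μ 8 3) (sym (^-assocʳ μ 6 4))) ⟩
    q ^ 4 * (μ ^ 6) ^ 4 ≡⟨ sym (^-distrib-* q (μ ^ 6) 4) ⟩
    (q * μ ^ 6) ^ 4     ≤⟨ p^k≤1 4 (0≤p*q 0≤q (0≤p^k 6 0≤μ)) qμ⁶≤1 ⟩
    1ℚ                  ∎
  split : ∀ q K → (q * K) * ((q * K) * ((q * K) * ((q * K) * 1ℚ)))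
                ≡ q * (q * (q * (q * 1ℚ))) * (K * (K * (K * 1ℚ))) * K
  split = solve-∀ ℚ-ring

LeTwoPow-intro : ∀ {x} n N → x ^ N * two ^ n ≤ 1ℚ → LeTwoPow x (1 ℕ.* n) N
LeTwoPow-intro {x} n N x^N*2^n≤1 = inj₂ (subst₂ (λ a b → a * b ≤ 1ℚ)
  (sym (^ℚ≗^ x N)) (sym (trans (^ℚ≗^ two (1 ℕ.* n)) (cong (two ^_) (ℕ.*-identityˡ n)))) x^N*2^n≤1)

Witness : ℕ → ℕ → Set
Witness n m =
  Σ (Bits n → ℚ) λ D →
    IsDistribution D × SymmetricDist D × Biased D (1 ℕ.* n) (128 ℕ.* m ℕ.^ 2) ×
    ((z : Bits n) → weight z ℕ.≤ m / 2 ℕ.∸ 1 →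
      Σ (Bits n → Bool) λ f →
        SymmetricFun f ×
        ((x : Bits n) → 0ℚ < D x → f (x ⊕ z) ≡ false) ×
        LeTwoPow (oneOver m - probUniform f) (1 ℕ.* n) (128 ℕ.* m ℕ.^ 2))

uniformWitness : ∀ n m → oneOver m ^ (128 ℕ.* m ℕ.^ 2) * two ^ n ≤ 1ℚ → Witness n m
uniformWitness n m 1/m≤ε =
  (λ _ → half ^ n) , ((λ _ → 0≤p^k n (0≤oneOver 2)) , total) , (λ _ _ → refl) , unbiased ,
  λ z _ → (λ _ → false) , (λ _ _ → refl) , (λ _ _ → refl) ,
    subst (λ p → LeTwoPow (oneOver m - p) (1 ℕ.* n) (128 ℕ.* m ℕ.^ 2)) (sym (trans (sumℚ-const n 0ℚ) (*-zeroʳ (two ^ n))))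
      (subst (λ x → LeTwoPow x (1 ℕ.* n) (128 ℕ.* m ℕ.^ 2)) (sym (+-identityʳ (oneOver m)))
        (LeTwoPow-intro n (128 ℕ.* m ℕ.^ 2) 1/m≤ε))
  where
  total : sumℚ {n} (λ _ → half ^ n) ≡ 1ℚ
  total = trans (sumℚ-const n (half ^ n)) (trans (*-comm (two ^ n) (half ^ n)) (half^n*two^n n))
  unbiased : Biased (λ _ → half ^ n) (1 ℕ.* n) (128 ℕ.* m ℕ.^ 2)
  unbiased S nonempty = inj₁ (≤-reflexive (cong ℚ.∣_∣ (charSum-const-nonempty S (half ^ n) nonempty)))

module ClassWitness (n m : ℕ) (m≥3 : 3 ℕ.≤ m) where

  h : ℕ
  h = m / 2

  open OddPeriod h

  L N : ℕ
  L = 16 ℕ.* m ℕ.^ 2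
  N = 128 ℕ.* m ℕ.^ 2

  μ 2ⁿ 2⁻ⁿ K η : ℚ
  μ = oneOver m
  2ⁿ = two ^ n
  2⁻ⁿ = half ^ n
  K = ρ ^ n
  -- Every error term below is shown to have its square bounded by η.
  η = fromℕ Q * K

  1≤m : 1 ℕ.≤ m
  1≤m = ℕ.≤-trans (s≤s z≤n) m≥3

  2≤m : 2 ℕ.≤ m
  2≤m = ℕ.≤-trans (s≤s (s≤s z≤n)) m≥3

  1≤h : 1 ℕ.≤ h
  1≤h = m≥n⇒m/n>0 2≤m

  M≤m+m : M ℕ.≤ m ℕ.+ m
  M≤m+m = ℕ.≤-trans (s≤s (subst (ℕ._≤ m) (twice h) (m/n*n≤m m 2))) (ℕ.+-monoˡ-≤ m 1≤m)
    where
    twice : ∀ h → h ℕ.* 2 ≡ h ℕ.+ h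
    twice = ℕ-solve-∀

  Q≤L : Q ℕ.≤ L
  Q≤L = subst (Q ℕ.≤_) (sixteen m) (ℕ.*-monoʳ-≤ 4 (ℕ.*-mono-≤ M≤m+m M≤m+m))
    where
    sixteen : ∀ m → 4 ℕ.* ((m ℕ.+ m) ℕ.* (m ℕ.+ m)) ≡ 16 ℕ.* (m ℕ.* (m ℕ.* 1))
    sixteen = ℕ-solve-∀

  0≤μ : 0ℚ ≤ μ
  0≤μ = 0≤oneOver m

  two*μ≤1 : two * μ ≤ 1ℚ
  two*μ≤1 = subst (two * μ ≤_) (trans (*-comm (fromℕ m) μ) (oneOver-inverse m 1≤m))
    (*-monoʳ-≤-0≤ μ 0≤μ (fromℕ-mono-≤ 2≤m))

  M*μ≤two : fromℕ M * μ ≤ two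
  M*μ≤two = begin
    fromℕ M * μ               ≤⟨ *-monoʳ-≤-0≤ μ 0≤μ (fromℕ-mono-≤ M≤m+m) ⟩
    fromℕ (m ℕ.+ m) * μ       ≡⟨ trans (cong (_* μ) (fromℕ-+ m m)) (*-distribʳ-+ μ (fromℕ m) (fromℕ m)) ⟩
    fromℕ m * μ + fromℕ m * μ ≡⟨ cong (λ x → x + x) (trans (*-comm (fromℕ m) μ) (oneOver-inverse m 1≤m)) ⟩
    two                       ∎
    where open ≤-Reasoning

  Q*μ⁶≤1 : fromℕ Q * μ ^ 6 ≤ 1ℚ
  Q*μ⁶≤1 = begin
    fromℕ Q * μ ^ 6                ≡⟨ trans (cong (_* μ ^ 6) fromℕ-Q) (regroup (fromℕ M) μ) ⟩
    four * (fromℕ M * μ) ² * μ ^ 4 ≤⟨ *-monoʳ-≤-0≤ (μ ^ 4) (0≤p^k 4 0≤μ) (*-monoˡ-≤-0≤ four 0≤four [Mμ]²≤two²) ⟩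
    four * two ² * μ ^ 4           ≡⟨ sym (^-distrib-* two μ 4) ⟩
    (two * μ) ^ 4                  ≤⟨ p^k≤1 4 (0≤p*q 0≤two 0≤μ) two*μ≤1 ⟩
    1ℚ                             ∎
    where
    open ≤-Reasoning
    0≤Mμ = 0≤p*q (0≤fromℕ M) 0≤μ
    [Mμ]²≤two² = *-mono-≤-nonNeg 0≤Mμ 0≤Mμ M*μ≤two M*μ≤two
    regroup : ∀ K μ → ((1ℚ + 1ℚ) + (1ℚ + 1ℚ)) * (K * K) * (μ * (μ * (μ * (μ * (μ * (μ * 1ℚ))))))
                    ≡ ((1ℚ + 1ℚ) + (1ℚ + 1ℚ)) * ((K * μ) * (K * μ)) * (μ * (μ * (μ * (μ * 1ℚ))))
    regroup = solve-∀ ℚ-ring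

  K^L*2ⁿ≤1 : K ^ L * 2ⁿ ≤ 1ℚ
  K^L*2ⁿ≤1 = begin
    (ρ ^ n) ^ L * two ^ n ≡⟨ cong (_* two ^ n) (trans (^-assocʳ ρ n L) (trans (cong (ρ ^_) (ℕ.*-comm n L)) (sym (^-assocʳ ρ L n)))) ⟩
    (ρ ^ L) ^ n * two ^ n ≡⟨ sym (^-distrib-* (ρ ^ L) two n) ⟩
    (ρ ^ L * two) ^ n     ≤⟨ p^k≤1 n (0≤p*q (0≤p^k L 0≤ρ) 0≤two) ρ^L*two≤1 ⟩
    1ℚ                    ∎
    where
    open ≤-Reasoning
    ρ^L*two≤1 = ≤-trans (*-monoʳ-≤-0≤ two 0≤two (^-antimonoʳ-≤ 0≤ρ ρ≤1 Q≤L)) ρ^Q*two≤1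

  module SmallError (1/m>ε : 1ℚ < μ ^ N * 2ⁿ) where

    0≤2ⁿ : 0ℚ ≤ 2ⁿ
    0≤2ⁿ = 0≤p^k n 0≤two

    K≤μ⁸ : K ≤ μ ^ 8
    K≤μ⁸ = p^k*r≤1<q^k*r⇒p≤q L (0≤p^k 8 0≤μ) 0≤2ⁿ K^L*2ⁿ≤1 (subst (λ x → 1ℚ < x * 2ⁿ) μ^N≡[μ⁸]^L 1/m>ε)
      where
      N≡8*L : ∀ m → 128 ℕ.* (m ℕ.* (m ℕ.* 1)) ≡ 8 ℕ.* (16 ℕ.* (m ℕ.* (m ℕ.* 1)))
      N≡8*L = ℕ-solve-∀
      μ^N≡[μ⁸]^L : μ ^ N ≡ (μ ^ 8) ^ L
      μ^N≡[μ⁸]^L = trans (cong (μ ^_) (N≡8*L m)) (sym (^-assocʳ μ 8 L))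

    η≤1 : η ≤ 1ℚ
    η≤1 = begin
      fromℕ Q * K             ≤⟨ *-monoˡ-≤-0≤ (fromℕ Q) (0≤fromℕ Q) K≤μ⁸ ⟩
      fromℕ Q * μ ^ 8         ≡⟨ trans (cong (fromℕ Q *_) (^-homo-* μ 6 2)) (sym (*-assoc (fromℕ Q) (μ ^ 6) (μ ^ 2))) ⟩
      fromℕ Q * μ ^ 6 * μ ^ 2 ≤⟨ p*q≤1 (0≤p*q (0≤fromℕ Q) (0≤p^k 6 0≤μ)) Q*μ⁶≤1 (0≤p^k 2 0≤μ) (p^k≤1 2 0≤μ (oneOver≤1 m)) ⟩
      1ℚ                      ∎
      where open ≤-Reasoning

    LeTwoPow-fromSq : ∀ {X} → 0ℚ ≤ X → X ² ≤ η → LeTwoPow X (1 ℕ.* n) N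
    LeTwoPow-fromSq {X} 0≤X X²≤η = LeTwoPow-intro n N (begin
      X ^ N * 2ⁿ               ≡⟨ cong (_* 2ⁿ) (trans (cong (X ^_) (N≡2*[4*L] m)) (sym (^-assocʳ X 2 (4 ℕ.* L)))) ⟩
      (X ^ 2) ^ (4 ℕ.* L) * 2ⁿ ≤⟨ *-monoʳ-≤-0≤ 2ⁿ 0≤2ⁿ (^-monoˡ-≤ (4 ℕ.* L) (0≤p^k 2 0≤X) X^2≤η) ⟩
      η ^ (4 ℕ.* L) * 2ⁿ       ≤⟨ error-budget L (0≤fromℕ Q) (0≤p^k n 0≤ρ) 0≤μ 0≤2ⁿ K^L*2ⁿ≤1 K≤μ⁸ Q*μ⁶≤1 ⟩
      1ℚ                       ∎)
      where
      open ≤-Reasoning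
      N≡2*[4*L] : ∀ m → 128 ℕ.* (m ℕ.* (m ℕ.* 1)) ≡ 2 ℕ.* (4 ℕ.* (16 ℕ.* (m ℕ.* (m ℕ.* 1))))
      N≡2*[4*L] = ℕ-solve-∀
      X^2≤η : X ^ 2 ≤ η
      X^2≤η = subst (_≤ η) (cong (X *_) (sym (*-identityʳ X))) X²≤η

    v : ℕ → ℚ
    v = classSums M (Vec.replicate n false)

    error-identity : four * 2⁻ⁿ ² * (fromℕ M ² * κ ^ n) ≡ η
    error-identity = begin
      four * 2⁻ⁿ ² * (fromℕ M ² * κ ^ n)         ≡⟨ cong (λ x → four * 2⁻ⁿ ² * (fromℕ M ² * x)) (trans (^-distrib-* four ρ n) (cong (_* K) (^-distrib-* two two n))) ⟩
      four * 2⁻ⁿ ² * (fromℕ M ² * (2ⁿ * 2ⁿ * K)) ≡⟨ regroup (fromℕ M) 2⁻ⁿ 2ⁿ K ⟩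
      four * fromℕ M ² * K * (2⁻ⁿ * 2ⁿ) ²        ≡⟨ cong (λ x → four * fromℕ M ² * K * x ²) (half^n*two^n n) ⟩
      four * fromℕ M ² * K * 1ℚ ²                ≡⟨ trans (*-identityʳ _) (cong (_* K) (sym fromℕ-Q)) ⟩
      η                                          ∎
      where
      open ≡-Reasoning
      regroup : ∀ M H P K → ((1ℚ + 1ℚ) + (1ℚ + 1ℚ)) * (H * H) * (M * M * (P * P * K))
                          ≡ ((1ℚ + 1ℚ) + (1ℚ + 1ℚ)) * (M * M) * K * ((H * P) * (H * P))
      regroup = solve-∀ ℚ-ring

    class-error : ∀ r → r ℕ.< M → four * (fromℕ M * (2⁻ⁿ * v r) - 1ℚ) ² ≤ η
    class-error r r<M = begin
      four * (fromℕ M * (2⁻ⁿ * v r) - 1ℚ) ²       ≡⟨ cong (λ y → four * (fromℕ M * (2⁻ⁿ * v r) - y) ²) (sym (half^n*two^n n)) ⟩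
      four * (fromℕ M * (2⁻ⁿ * v r) - 2⁻ⁿ * 2ⁿ) ² ≡⟨ factor (fromℕ M) 2⁻ⁿ (v r) 2ⁿ ⟩
      four * 2⁻ⁿ ² * (fromℕ M * v r - 2ⁿ) ²       ≤⟨ *-monoˡ-≤-0≤ (four * 2⁻ⁿ ²) (0≤p*q 0≤four (0≤p² 2⁻ⁿ)) (classSums-allFalse-bound n r r<M) ⟩
      four * 2⁻ⁿ ² * (fromℕ M ² * κ ^ n)          ≡⟨ error-identity ⟩
      η                                           ∎
      where
      open ≤-Reasoning
      factor : ∀ M H x P → ((1ℚ + 1ℚ) + (1ℚ + 1ℚ)) * ((M * (H * x) - H * P) * (M * (H * x) - H * P))
                        ≡ ((1ℚ + 1ℚ) + (1ℚ + 1ℚ)) * (H * H) * ((M * x - P) * (M * x - P))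
      factor = solve-∀ ℚ-ring

    A : ℚ
    A = v 0

    1≤2*M*2⁻ⁿ*A : 1ℚ ≤ two * fromℕ M * 2⁻ⁿ * A
    1≤2*M*2⁻ⁿ*A = ≤-byDifference (two * y + 1ℚ) (subst (0ℚ ≤_) (shift (two * y)) (p≤q⇒0≤q-p -1≤2y))
                   (rearrange (fromℕ M) 2⁻ⁿ A)
      where
      y = fromℕ M * (2⁻ⁿ * A) - 1ℚ
      -1≤2y : - 1ℚ ≤ two * y
      -1≤2y = p²≤b²⇒-b≤p 0≤1 (≤-trans (≤-reflexive (double² y)) (≤-trans (class-error 0 (s≤s z≤n)) η≤1))
        where
        double² : ∀ y → (1ℚ + 1ℚ) * y * ((1ℚ + 1ℚ) * y) ≡ ((1ℚ + 1ℚ) + (1ℚ + 1ℚ)) * (y * y)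
        double² = solve-∀ ℚ-ring
      shift : ∀ t → t - - 1ℚ ≡ t + 1ℚ
      shift = solve-∀ ℚ-ring
      rearrange : ∀ M H A → (1ℚ + 1ℚ) * M * H * A - 1ℚ ≡ (1ℚ + 1ℚ) * (M * (H * A) - 1ℚ) + 1ℚ
      rearrange = solve-∀ ℚ-ring

    0≤2*M*2⁻ⁿ : 0ℚ ≤ two * fromℕ M * 2⁻ⁿ
    0≤2*M*2⁻ⁿ = 0≤p*q (0≤p*q 0≤two (0≤fromℕ M)) (0≤p^k n (0≤oneOver 2))

    0<A : 0ℚ < A
    0<A = 1≤p*q⇒0<q 0≤2*M*2⁻ⁿ 1≤2*M*2⁻ⁿ*A

    instance
      A≢0 : ℚ.NonZero A
      A≢0 = ℚ.>-nonZero 0<A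

    a : ℚ
    a = 1/ A

    0≤a : 0ℚ ≤ a
    0≤a = <⇒≤ (positive⁻¹ a {{1/pos⇒pos A {{positive 0<A}}}})

    a≤2*M*2⁻ⁿ : a ≤ two * fromℕ M * 2⁻ⁿ
    a≤2*M*2⁻ⁿ = begin
      a                             ≡⟨ sym (*-identityʳ a) ⟩
      a * 1ℚ                        ≤⟨ *-monoˡ-≤-0≤ a 0≤a 1≤2*M*2⁻ⁿ*A ⟩
      a * (two * fromℕ M * 2⁻ⁿ * A) ≡⟨ trans (*-comm a (two * fromℕ M * 2⁻ⁿ * A)) (*-assoc (two * fromℕ M * 2⁻ⁿ) A a) ⟩
      two * fromℕ M * 2⁻ⁿ * (A * a) ≡⟨ trans (cong (two * fromℕ M * 2⁻ⁿ *_) (*-inverseʳ A)) (*-identityʳ (two * fromℕ M * 2⁻ⁿ)) ⟩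
      two * fromℕ M * 2⁻ⁿ           ∎
      where open ≤-Reasoning

    D : Bits n → ℚ
    D x = 𝟙 (inClass M 0 (weight x)) * a

    D-bias : ∀ S → bias D S ≡ a * classSums M S 0
    D-bias S = trans (sumℚ-cong (λ x → reorder (𝟙 (inClass M 0 (weight x))) a (sign (parity S x))))
                     (sym (*-distribˡ-sumℚ a (λ x → 𝟙 (inClass M 0 (weight x)) * sign (parity S x))))
      where
      reorder : ∀ d a s → d * a * s ≡ a * (d * s)
      reorder = solve-∀ ℚ-ring

    D-distribution : IsDistribution D
    D-distribution = (λ x → 0≤p*q (0≤𝟙 (inClass M 0 (weight x))) 0≤a) , (begin
      sumℚ D                         ≡⟨ sumℚ-cong (λ x → sym (trans (cong (λ b → D x * sign b) (parity-allFalse x)) (*-identityʳ (D x)))) ⟩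
      bias D (Vec.replicate n false) ≡⟨ D-bias (Vec.replicate n false) ⟩
      a * A                          ≡⟨ *-inverseˡ A ⟩
      1ℚ                             ∎)
      where open ≡-Reasoning

    D-symmetric : SymmetricDist D
    D-symmetric π x = cong (λ w → 𝟙 (inClass M 0 w) * a) (weight-permute π x)

    D-biased : Biased D (1 ℕ.* n) N
    D-biased S nonempty = LeTwoPow-fromSq (0≤∣p∣ (bias D S)) (begin
      ℚ.∣ bias D S ∣ ²                    ≡⟨ trans (∣p∣²≡p² (bias D S)) (cong _² (D-bias S)) ⟩
      (a * classSums M S 0) ²             ≡⟨ distribute a (classSums M S 0) ⟩
      a ² * classSums M S 0 ²             ≤⟨ *-mono-≤-nonNeg (0≤p² a) (0≤p² (classSums M S 0)) a²≤[2*M*2⁻ⁿ]² (classSums-nonempty-bound S nonempty) ⟩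
      (two * fromℕ M * 2⁻ⁿ) ² * κ ^ n    ≡⟨ regroup (fromℕ M) 2⁻ⁿ (κ ^ n) ⟩
      four * 2⁻ⁿ ² * (fromℕ M ² * κ ^ n) ≡⟨ error-identity ⟩
      η                                  ∎)
      where
      open ≤-Reasoning
      a²≤[2*M*2⁻ⁿ]² = *-mono-≤-nonNeg 0≤a 0≤a a≤2*M*2⁻ⁿ a≤2*M*2⁻ⁿ
      distribute : ∀ a x → a * x * (a * x) ≡ a * a * (x * x)
      distribute = solve-∀ ℚ-ring
      regroup : ∀ M H k → (1ℚ + 1ℚ) * M * H * ((1ℚ + 1ℚ) * M * H) * k ≡ ((1ℚ + 1ℚ) + (1ℚ + 1ℚ)) * (H * H) * (M * M * k)
      regroup = solve-∀ ℚ-ring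

    test : Bits n → Bool
    test y = inClass M h (weight y) ∨ inClass M (suc h) (weight y)

    test-symmetric : SymmetricFun test
    test-symmetric π y = cong (λ w → inClass M h w ∨ inClass M (suc h) w) (weight-permute π y)

    test-rejects : ∀ z → weight z ℕ.≤ h ℕ.∸ 1 → ∀ x → 0ℚ < D x → test (x ⊕ z) ≡ false
    test-rejects z k≤h-1 x 0<Dx = cong₂ _∨_ (avoids h k<h k+h<M) (avoids (suc h) (ℕ.m<n⇒m<1+n k<h) k+suc[h]<M)
      where
      k = weight z
      w = weight x
      y = weight (x ⊕ z)
      M∣w : M ∣ w
      M∣w = subst (M ∣_) (ℕ.+-identityʳ w) (dec-true⁻¹ (M ∣? w ℕ.+ 0) (𝟙*p>0⇒true (inClass M 0 w) 0<Dx))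
      w≤y+k : w ℕ.≤ y ℕ.+ k
      w≤y+k = subst (ℕ._≤ y ℕ.+ k) (cong weight (⊕-involutive x z)) (weight-⊕ (x ⊕ z) z)
      k<h : k ℕ.< h
      k<h = ℕ.≤-<-trans k≤h-1 (ℕ.∸-monoʳ-< (s≤s z≤n) 1≤h)
      k+h<M : k ℕ.+ h ℕ.< M
      k+h<M = ℕ.m<n⇒m<1+n (ℕ.+-monoˡ-< h k<h)
      k+suc[h]<M : k ℕ.+ suc h ℕ.< M
      k+suc[h]<M = subst (ℕ._< M) (sym (ℕ.+-suc k h)) (s≤s (ℕ.+-monoˡ-< h k<h))
      avoids : ∀ r → k ℕ.< r → k ℕ.+ r ℕ.< M → inClass M r y ≡ false
      avoids r k<r k+r<M = dec-false (M ∣? y ℕ.+ r) (no-multiple-near M∣w w≤y+k (weight-⊕ x z) k<r k+r<M)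

    classes-disjoint : ∀ w → inClass M h w ≡ true → inClass M (suc h) w ≡ false
    classes-disjoint w inₕ = dec-false (M ∣? w ℕ.+ suc h) (λ M∣w+h+1 → ℕ.<⇒≢ 1<M (sym (∣1⇒≡1
      (∣m+n∣m⇒∣n (subst (M ∣_) (trans (ℕ.+-suc w h) (ℕ.+-comm 1 (w ℕ.+ h))) M∣w+h+1) (dec-true⁻¹ (M ∣? w ℕ.+ h) inₕ)))))
      where
      1<M : 1 ℕ.< M
      1<M = s≤s (ℕ.≤-trans 1≤h (ℕ.m≤m+n h h))

    test-probability : probUniform test ≡ 2⁻ⁿ * (v h + v (suc h))
    test-probability = begin
      probUniform test                         ≡⟨ sumℚ-cong (λ x → cong (λ c → if test x then c else 0ℚ) (^ℚ≗^ half n)) ⟩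
      sumℚ (λ x → if test x then 2⁻ⁿ else 0ℚ)  ≡⟨ sumℚ-cong (λ x → trans (if-∨ _ _ 2⁻ⁿ (classes-disjoint (weight x))) (cong (2⁻ⁿ *_) (unsign x))) ⟩
      sumℚ (λ x → 2⁻ⁿ * (g h x + g (suc h) x)) ≡⟨ sym (*-distribˡ-sumℚ 2⁻ⁿ (λ x → g h x + g (suc h) x)) ⟩
      2⁻ⁿ * sumℚ (λ x → g h x + g (suc h) x)   ≡⟨ cong (2⁻ⁿ *_) (sumℚ-+ (g h) (g (suc h))) ⟩
      2⁻ⁿ * (v h + v (suc h))                  ∎
      where
      open ≡-Reasoning
      g : ℕ → Bits n → ℚ
      g r x = 𝟙 (inClass M r (weight x)) * sign (parity (Vec.replicate n false) x)
      unsign : ∀ x → 𝟙 (inClass M h (weight x)) + 𝟙 (inClass M (suc h) (weight x)) ≡ g h x + g (suc h) x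
      unsign x = sym (cong₂ _+_ (unsign₁ h) (unsign₁ (suc h)))
        where
        unsign₁ : ∀ r → g r x ≡ 𝟙 (inClass M r (weight x))
        unsign₁ r = trans (cong (λ b → 𝟙 (inClass M r (weight x)) * sign b) (parity-allFalse x)) (*-identityʳ _)

    deficit² : 0ℚ ≤ μ - 2⁻ⁿ * (v h + v (suc h)) → (μ - 2⁻ⁿ * (v h + v (suc h))) ² ≤ η
    deficit² 0≤d = begin
      d ²                     ≤⟨ *-mono-≤-nonNeg 0≤d 0≤d d≤Md d≤Md ⟩
      (fromℕ M * d) ²         ≤⟨ *-mono-≤-nonNeg 0≤Md 0≤Md Md≤-[e+e′] Md≤-[e+e′] ⟩
      (- (e h + e (suc h))) ² ≡⟨ neg² (e h + e (suc h)) ⟩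
      (e h + e (suc h)) ²     ≤⟨ ≤-byDifference _ slack (split η (e h) (e (suc h))) ⟩
      η                       ∎
      where
      open ≤-Reasoning
      d = μ - 2⁻ⁿ * (v h + v (suc h))
      e : ℕ → ℚ
      e r = fromℕ M * (2⁻ⁿ * v r) - 1ℚ
      0≤Md : 0ℚ ≤ fromℕ M * d
      0≤Md = 0≤p*q (0≤fromℕ M) 0≤d
      d≤Md : d ≤ fromℕ M * d
      d≤Md = subst (_≤ fromℕ M * d) (*-identityˡ d) (*-monoʳ-≤-0≤ d 0≤d (fromℕ-mono-≤ (s≤s (z≤n {h ℕ.+ h}))))
      Md≤-[e+e′] : fromℕ M * d ≤ - (e h + e (suc h))
      Md≤-[e+e′] = ≤-byDifference (two - fromℕ M * μ) (p≤q⇒0≤q-p M*μ≤two) (expand (fromℕ M) μ 2⁻ⁿ (v h) (v (suc h)))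
        where
        expand : ∀ M μ H a b → - (M * (H * a) - 1ℚ + (M * (H * b) - 1ℚ)) - M * (μ - H * (a + b)) ≡ (1ℚ + 1ℚ) - M * μ
        expand = solve-∀ ℚ-ring
      half*slack : ∀ r → r ℕ.< M → 0ℚ ≤ half * (η - four * e r ²)
      half*slack r r<M = 0≤p*q (0≤oneOver 2) (p≤q⇒0≤q-p (class-error r r<M))
      h<M : h ℕ.< M
      h<M = s≤s (ℕ.m≤m+n h h)
      h+1≤h+h : suc h ℕ.≤ h ℕ.+ h
      h+1≤h+h = subst (ℕ._≤ h ℕ.+ h) (ℕ.+-comm h 1) (ℕ.+-monoʳ-≤ h 1≤h)
      slack = 0≤p+q (0≤p+q (half*slack h h<M) (half*slack (suc h) (s≤s h+1≤h+h))) (0≤p² (e h - e (suc h)))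
      neg² : ∀ x → - x * - x ≡ x * x
      neg² = solve-∀ ℚ-ring
      split : ∀ η e e′ → η - (e + e′) * (e + e′)
                       ≡ half * (η - ((1ℚ + 1ℚ) + (1ℚ + 1ℚ)) * (e * e))
                         + half * (η - ((1ℚ + 1ℚ) + (1ℚ + 1ℚ)) * (e′ * e′))
                         + (e - e′) * (e - e′)
      split = solve-∀ ℚ-ring

    deficit-LeTwoPow : LeTwoPow (μ - 2⁻ⁿ * (v h + v (suc h))) (1 ℕ.* n) N
    deficit-LeTwoPow with ≤-total (μ - 2⁻ⁿ * (v h + v (suc h))) 0ℚ
    ... | inj₁ d≤0 = inj₁ d≤0
    ... | inj₂ 0≤d = LeTwoPow-fromSq 0≤d (deficit² 0≤d)

    witness : Witness n m
    witness = D , D-distribution , D-symmetric , D-biased , λ z k≤h-1 →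
      test , test-symmetric , test-rejects z k≤h-1 ,
      subst (λ p → LeTwoPow (μ - p) (1 ℕ.* n) N) (sym test-probability) deficit-LeTwoPow

witness : ∀ n m → 3 ℕ.≤ m → Witness n m
witness n m m≥3 with oneOver m ^ (128 ℕ.* m ℕ.^ 2) * two ^ n ≤? 1ℚ
... | yes 1/m≤ε = uniformWitness n m 1/m≤ε
... | no  1/m≰ε = ClassWitness.SmallError.witness n m m≥3 (≰⇒> 1/m≰ε)

mainTheorem15 :
    Σ ℕ λ p → Σ ℕ λ r → (1 ℕ.≤ p) × (1 ℕ.≤ r) ×
      ((n m : ℕ) → m ℕ.≥ 3 →
        Σ (Bits n → ℚ) λ D →
          IsDistribution D × SymmetricDist D × Biased D (p ℕ.* n) (r ℕ.* m ℕ.^ 2) ×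
          ((z : Bits n) → weight z ℕ.≤ m / 2 ℕ.∸ 1 →
            Σ (Bits n → Bool) λ f →
              SymmetricFun f ×
              ((x : Bits n) → 0ℚ < D x → f (x ⊕ z) ≡ false) ×
              LeTwoPow (oneOver m - probUniform f) (p ℕ.* n) (r ℕ.* m ℕ.^ 2)))
mainTheorem15 = 1 , 128 , s≤s z≤n , s≤s z≤n , witness
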